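{- For every $n\ge 1$, $b_{n,4}(\Delta_{n-1})=\sum_{i=0}^{n-1}\frac{n!}{i!}$.
   Context: For $n\ge1$, $B_n^+$ is the monoid generated by $\sigma_1,\dots,\sigma_{n-1}$ subject to $\sigma_i\sigma_j=\sigma_j\sigma_i$ for $|i-j|\ge 2$ and $\sigma_i\sigma_j\sigma_i=\sigma_j\sigma_i\sigma_j$ for $|i-j|=1$; $B_m^+\subseteq B_n^+$ for $m\le n$. $x$ is a left divisor of $y$ if $y=xz$ for some $z\in B_n^+$. Define $\Delta_0=\Delta_1=1$, $\Delta_m=\sigma_1\cdots\sigma_{m-1}\Delta_{m-1}$. A positive $n$-braid is simple if it is a left divisor of $\Delta_n$. For simple $x$, $D_L(x)$ (resp. $D_R(x)$) is the set of $i\in\{1,\dots,n-1\}$ with $\sigma_i$ a left (resp. right) divisor of $x$. A sequence $(x_1,\dots,x_d)$ of simple $n$-braids is normal if $x_k$ is the left gcd of $\Delta_n$ and $x_k\cdots x_d$ for each $k$; equivalently $D_R(x_k)\supseteq D_L(x_{k+1})$ for all $k<d$. Every positive $n$-braid has a unique normal expression padded on the right by factors $1$; degree at most $d$ means all factors after the $d$th are $1$. $b_{n,d}(x)$ denotes the number of positive $n$-braids of degree at most $d$ whose $d$th normal factor equals $x$, i.e. the number of normal sequences $(x_1,\dots,x_{d-1},x)$ of simple $n$-braids. -}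

module Defs where

open import Data.Nat using (ℕ; zero; suc; _+_; _∸_; _<_; _≤_; _!; _/_)
open import Data.Nat.Properties using (_!≢0)
open import Data.List using (List; []; _∷_; _++_; [_]; length)
open import Data.List.Relation.Unary.All using (All)
open import Data.List.Relation.Unary.Any using (Any)
open import Data.List.Relation.Unary.AllPairs using (AllPairs)
open import Data.Vec using (Vec; toList)
open import Data.Vec.Relation.Binary.Pointwise.Inductive using (Pointwise)
open import Data.Product using (Σ; _×_; Σ-syntax)
open import Relation.Nullary using (¬_)
open import Data.Unit using (⊤)
open import Relation.Binary.PropositionalEquality using (_≡_)

-- Positive braid words: a letter i : ℕ stands for the generator σ_i.
Word : Set
Word = List ℕ

Valid : ℕ → Word → Set
Valid n w = All (λ i → 0 < i × i < n) w

infix 4 _≈_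
data _≈_ : Word → Word → Set where
  ≈-refl  : ∀ {u} → u ≈ u
  ≈-sym   : ∀ {u v} → u ≈ v → v ≈ u
  ≈-trans : ∀ {u v w} → u ≈ v → v ≈ w → u ≈ w
  ≈-comm  : ∀ u v i j → suc (suc i) ≤ j →
            u ++ i ∷ j ∷ v ≈ u ++ j ∷ i ∷ v
  ≈-braid : ∀ u v i j → j ≡ suc i →
            u ++ i ∷ j ∷ i ∷ v ≈ u ++ j ∷ i ∷ j ∷ v

seg : ℕ → Word
seg zero    = []
seg (suc k) = seg k ++ [ suc k ]

Δ : ℕ → Word
Δ zero    = []
Δ (suc m) = seg m ++ Δ m

LeftDiv : ℕ → Word → Word → Set
LeftDiv n x y = Σ[ z ∈ Word ] (Valid n z × (x ++ z ≈ y))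

RightDiv : ℕ → Word → Word → Set
RightDiv n x y = Σ[ z ∈ Word ] (Valid n z × (z ++ x ≈ y))

Simple : ℕ → Word → Set
Simple n x = Valid n x × LeftDiv n x (Δ n)

DRsupDL : ℕ → Word → Word → Set
DRsupDL n x y = ∀ i → 0 < i → i < n → LeftDiv n [ i ] y → RightDiv n [ i ] x

NormalChain : ℕ → List Word → Set
NormalChain n []           = ⊤
NormalChain n (x ∷ [])     = ⊤
NormalChain n (x ∷ y ∷ xs) = DRsupDL n x y × NormalChain n (y ∷ xs)

Normal : ℕ → List Word → Set
Normal n xs = All (Simple n) xs × NormalChain n xs

NormalPrefix : ℕ → (d : ℕ) → Word → Vec Word (d ∸ 1) → Set
NormalPrefix n d x v = Normal n (toList v ++ [ x ])

BCount : ℕ → ℕ → Word → ℕ → Set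
BCount n d x k =
  Σ[ L ∈ List (Vec Word (d ∸ 1)) ]
    ( All (NormalPrefix n d x) L
    × AllPairs (λ u v → ¬ Pointwise _≈_ u v) L
    × (∀ v → NormalPrefix n d x v → Any (Pointwise _≈_ v) L)
    × length L ≡ k )

sumBelow : ℕ → (ℕ → ℕ) → ℕ
sumBelow zero    f = 0
sumBelow (suc m) f = sumBelow m f + f m

factQuot : ℕ → ℕ → ℕ
factQuot n i = (n ! / i !) {{i !≢0}}

-- Simple n-braids are the reduced words of permutations.  We represent a permutation by its Lehmer-type
-- code c (each entry bounded by the number of entries after it), with canonical word codeWord c, a product
-- of descending runs, and read both descent sets of codeWord c off the code.  In a normal sequence
-- (x₁, x₂, x₃, Δ_{n-1}) the condition D_R(x₃) ⊇ D_L(Δ_{n-1}) = {1, …, n-2} forces x₃ to have code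
-- 0^r j 0^j with r + j + 1 = n; then D_R(x₂) ⊇ D_L(x₃), all generators but σ_j, forces x₂ to have the
-- code code₂ s of a bit string s with j ones; and x₁ is the reverse of some codeWord d, so that
-- D_R(x₁) = D_L(codeWord d) ⊇ D_L(x₂) becomes a condition on adjacent pairs of the marked list zip s d.
-- Hence the normal sequences are in bijection with the compatible marked lists of length n with fewer than
-- n marks.  Such a list splits uniquely into blocks (marked entries followed by unmarked ones, with weakly
-- increasing code entries) separated at cuts, and counting block by block gives n! lists that start with a
-- mark and Σ_{i<n} n!/i! lists with fewer than n marks.

module Submission where

open import Defs
open import Data.Nat using (ℕ; zero; suc; _+_; _*_; _∸_; _<_; _≤_; z≤n; s≤s; z<s; _!; _/_; _≡ᵇ_; _≤ᵇ_; _<ᵇ_)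
open import Data.Nat.Properties
open import Data.Nat.DivMod using (m*n/n≡m)
open import Data.Bool using (Bool; true; false; if_then_else_; T; not; _∧_)
open import Data.List using (List; []; applyUpTo; _∷_; _++_; [_]; length; reverse; map; downFrom; take; drop; _∷ʳ_; upTo; replicate; concatMap)
open import Data.List.Properties using (++-assoc; ++-identityʳ; length-++; reverse-++; unfold-reverse; reverse-involutive; take++drop≡id; length-take; length-drop; ∷-injective; ∷-injectiveˡ; ∷-injectiveʳ; length-map; map-injective; map-++; ++-cancelˡ; length-upTo; length-downFrom; upTo-∷ʳ; reverse-upTo)
open import Data.List.Reverse using (Reverse; []; _∶_∶ʳ_; reverseView)
open import Data.List.Relation.Unary.All using (All; []; _∷_) renaming (map to All-map; tabulate to All-tab; lookup to All-lookup)
open import Data.List.Relation.Unary.All.Properties using (++⁺; ++⁻ˡ; ++⁻ʳ; applyUpTo⁺₁) renaming (map⁺ to All-map⁺)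
open import Data.List.Relation.Unary.Any using (Any; here; there) renaming (map to Any-map)
open import Data.List.Relation.Unary.AllPairs using (AllPairs; []; _∷_)
open import Data.List.Relation.Unary.Unique.Propositional using (Unique)
open import Data.List.Relation.Unary.Unique.Propositional.Properties using (upTo⁺) renaming (++⁺ to Unique-++⁺; map⁺ to Unique-map⁺)
open import Data.List.Membership.Propositional using (_∈_; lose; find)
open import Data.List.Membership.Propositional.Properties using (∈-map⁺; ∈-map⁻; ∈-++⁺ˡ; ∈-++⁺ʳ; ∈-++⁻; ∈-concatMap⁺; ∈-concatMap⁻; ∈-upTo⁺; ∈-upTo⁻)
open import Data.Vec using (Vec; toList) renaming ([] to v[]; _∷_ to _v∷_)
open import Data.Vec.Relation.Binary.Pointwise.Inductive using (Pointwise) renaming ([] to p[]; _∷_ to _p∷_)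
open import Data.Sum using (_⊎_; inj₁; inj₂)
open import Data.Empty using (⊥-elim; ⊥)
open import Data.Unit using (⊤; tt)
open import Data.Product using (Σ; _×_; _,_; proj₁; proj₂; uncurry)
open import Relation.Nullary using (¬_; yes; no)
open import Level using (0ℓ)
open import Function using (id; _∘_)
open import Relation.Binary using (Setoid; tri<; tri≈; tri>)
import Relation.Binary.Reasoning.Setoid as SetoidReasoning
open import Algebra.Properties.CommutativeSemigroup *-commutativeSemigroup using () renaming (x∙yz≈y∙xz to x*[y*z]≡y*[x*z])
open import Algebra.Properties.CommutativeSemigroup +-commutativeSemigroup using () renaming (x∙yz≈y∙xz to x+[y+z]≡y+[x+z])
open import Relation.Binary.PropositionalEquality using (_≡_; _≢_; refl; sym; trans; cong; cong₂; subst; subst₂; module ≡-Reasoning)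

-- The braid congruence

≈-subst : ∀ {u u' v v'} → u ≡ u' → v ≡ v' → u ≈ v → u' ≈ v'
≈-subst refl refl p = p

≈-reflexive : ∀ {u v} → u ≡ v → u ≈ v
≈-reflexive refl = ≈-refl

≈-setoid : Setoid 0ℓ 0ℓ
≈-setoid = record
  { Carrier       = Word
  ; _≈_           = _≈_
  ; isEquivalence = record { refl = ≈-refl ; sym = ≈-sym ; trans = ≈-trans }
  }

module ≈-Reasoning = SetoidReasoning ≈-setoid

≈-++ˡ : ∀ w {x y} → x ≈ y → w ++ x ≈ w ++ y
≈-++ˡ w ≈-refl = ≈-refl
≈-++ˡ w (≈-sym p) = ≈-sym (≈-++ˡ w p)
≈-++ˡ w (≈-trans p q) = ≈-trans (≈-++ˡ w p) (≈-++ˡ w q)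
≈-++ˡ w (≈-comm u v i j h) =
  ≈-subst (++-assoc w u _) (++-assoc w u _) (≈-comm (w ++ u) v i j h)
≈-++ˡ w (≈-braid u v i j h) =
  ≈-subst (++-assoc w u _) (++-assoc w u _) (≈-braid (w ++ u) v i j h)

≈-++ʳ : ∀ w {x y} → x ≈ y → x ++ w ≈ y ++ w
≈-++ʳ w ≈-refl = ≈-refl
≈-++ʳ w (≈-sym p) = ≈-sym (≈-++ʳ w p)
≈-++ʳ w (≈-trans p q) = ≈-trans (≈-++ʳ w p) (≈-++ʳ w q)
≈-++ʳ w (≈-comm u v i j h) =
  ≈-subst (sym (++-assoc u (i ∷ j ∷ v) w)) (sym (++-assoc u (j ∷ i ∷ v) w)) (≈-comm u (v ++ w) i j h)
≈-++ʳ w (≈-braid u v i j h) =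
  ≈-subst (sym (++-assoc u (i ∷ j ∷ i ∷ v) w)) (sym (++-assoc u (j ∷ i ∷ j ∷ v) w)) (≈-braid u (v ++ w) i j h)

module _ {Q : ℕ → Set} where

  private
    All-swap : ∀ u {a b v} → All Q (u ++ a ∷ b ∷ v) → All Q (u ++ b ∷ a ∷ v)
    All-swap u qs with ++⁻ʳ u qs
    ... | qa ∷ qb ∷ qv = ++⁺ (++⁻ˡ u qs) (qb ∷ qa ∷ qv)

    All-braid : ∀ u {a b v} → All Q (u ++ a ∷ b ∷ a ∷ v) → All Q (u ++ b ∷ a ∷ b ∷ v)
    All-braid u qs with ++⁻ʳ u qs
    ... | qa ∷ qb ∷ _ ∷ qv = ++⁺ (++⁻ˡ u qs) (qb ∷ qa ∷ qb ∷ qv)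

  All-resp-≈ : ∀ {u v} → u ≈ v → All Q u → All Q v
  All-resp-≈⁻ : ∀ {u v} → u ≈ v → All Q v → All Q u

  All-resp-≈ ≈-refl = id
  All-resp-≈ (≈-sym p) = All-resp-≈⁻ p
  All-resp-≈ (≈-trans p q) = All-resp-≈ q ∘ All-resp-≈ p
  All-resp-≈ (≈-comm u _ _ _ _) = All-swap u
  All-resp-≈ (≈-braid u _ _ _ _) = All-braid u

  All-resp-≈⁻ ≈-refl = id
  All-resp-≈⁻ (≈-sym p) = All-resp-≈ p
  All-resp-≈⁻ (≈-trans p q) = All-resp-≈⁻ p ∘ All-resp-≈⁻ q
  All-resp-≈⁻ (≈-comm u _ _ _ _) = All-swap u
  All-resp-≈⁻ (≈-braid u _ _ _ _) = All-braid u

length-resp-≈ : ∀ {u v} → u ≈ v → length u ≡ length v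
length-resp-≈ ≈-refl = refl
length-resp-≈ (≈-sym p) = sym (length-resp-≈ p)
length-resp-≈ (≈-trans p q) = trans (length-resp-≈ p) (length-resp-≈ q)
length-resp-≈ (≈-comm u v i j h) = trans (length-++ u) (sym (length-++ u))
length-resp-≈ (≈-braid u v i j h) = trans (length-++ u) (sym (length-++ u))

reverse-++-++ : ∀ {A : Set} (u xs v : List A) → reverse (u ++ xs ++ v) ≡ reverse v ++ reverse xs ++ reverse u
reverse-++-++ u xs v = begin
  reverse (u ++ xs ++ v)                  ≡⟨ reverse-++ u (xs ++ v) ⟩
  reverse (xs ++ v) ++ reverse u          ≡⟨ cong (_++ reverse u) (reverse-++ xs v) ⟩
  (reverse v ++ reverse xs) ++ reverse u  ≡⟨ ++-assoc (reverse v) (reverse xs) (reverse u) ⟩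
  reverse v ++ reverse xs ++ reverse u    ∎
  where open ≡-Reasoning

≈-reverse : ∀ {u v} → u ≈ v → reverse u ≈ reverse v
≈-reverse ≈-refl = ≈-refl
≈-reverse (≈-sym p) = ≈-sym (≈-reverse p)
≈-reverse (≈-trans p q) = ≈-trans (≈-reverse p) (≈-reverse q)
≈-reverse (≈-comm u v i j h) =
  ≈-subst (sym (reverse-++-++ u (i ∷ j ∷ []) v)) (sym (reverse-++-++ u (j ∷ i ∷ []) v))
          (≈-sym (≈-comm (reverse v) (reverse u) i j h))
≈-reverse (≈-braid u v i j h) =
  ≈-subst (sym (reverse-++-++ u (i ∷ j ∷ i ∷ []) v)) (sym (reverse-++-++ u (j ∷ i ∷ j ∷ []) v))
          (≈-braid (reverse v) (reverse u) i j h)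

-- Descending runs

Far : ℕ → ℕ → Set
Far a x = suc (suc a) ≤ x ⊎ suc (suc x) ≤ a

far-swap : ∀ {a b} v → Far a b → a ∷ b ∷ v ≈ b ∷ a ∷ v
far-swap {a} {b} v (inj₁ h) = ≈-comm [] v a b h
far-swap {a} {b} v (inj₂ h) = ≈-sym (≈-comm [] v b a h)

far-∷≈∷ʳ : ∀ {a} X → All (Far a) X → a ∷ X ≈ X ++ [ a ]
far-∷≈∷ʳ [] [] = ≈-refl
far-∷≈∷ʳ (x ∷ X) (f ∷ fs) = ≈-trans (far-swap X f) (≈-++ˡ [ x ] (far-∷≈∷ʳ X fs))

far-++∷≈∷++ : ∀ {a} X Y → All (Far a) X → X ++ a ∷ Y ≈ a ∷ X ++ Y
far-++∷≈∷++ {a} X Y fs = ≈-subst (++-assoc X [ a ] Y) refl (≈-sym (≈-++ʳ Y (far-∷≈∷ʳ X fs)))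

far-blocks-commute : ∀ X Y → All (λ x → All (Far x) Y) X → X ++ Y ≈ Y ++ X
far-blocks-commute [] Y [] = ≈-subst refl (sym (++-identityʳ Y)) ≈-refl
far-blocks-commute (x ∷ X) Y (f ∷ fs) =
  ≈-trans (≈-++ˡ [ x ] (far-blocks-commute X Y fs))
  (≈-subst refl (++-assoc Y [ x ] X) (≈-++ʳ X (far-∷≈∷ʳ Y f)))

run : ℕ → ℕ → Word
run p zero = []
run p (suc k) = suc (k + p) ∷ run p k

All-run : ∀ {Q : ℕ → Set} p k → (∀ x → p < x → x ≤ k + p → Q x) → All Q (run p k)
All-run p zero f = []
All-run p (suc k) f = f (suc (k + p)) (s≤s (m≤n+m p k)) ≤-refl
  ∷ All-run p k (λ x h1 h2 → f x h1 (≤-trans h2 (n≤1+n (k + p))))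

run-+ : ∀ p k e → run p (k + e) ≡ run (e + p) k ++ run p e
run-+ p zero e = refl
run-+ p (suc k) e = cong₂ _∷_ (cong suc (+-assoc k e p)) (run-+ p k e)

run-∷ʳ : ∀ p k → run p (suc k) ≡ run (suc p) k ++ [ suc p ]
run-∷ʳ p zero = refl
run-∷ʳ p (suc k) = cong₂ _∷_ (cong suc (sym (+-suc k p))) (run-∷ʳ p k)

run-far-above : ∀ a p k → suc (k + p) < a → All (Far a) (run p k)
run-far-above a p k h = All-run p k (λ x _ h2 → inj₂ (≤-trans (s≤s (s≤s h2)) h))

run-far-below : ∀ a p k → suc a < suc p → All (Far a) (run p k)
run-far-below a p k h = All-run p k (λ x h1 _ → inj₁ (≤-trans h h1))

run-∷ʳ-suc : ∀ p k b → p < b → b < k + p → run p k ++ [ suc b ] ≈ b ∷ run p k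
run-∷ʳ-suc p zero b p<b b<p = ⊥-elim (<-asym p<b b<p)
run-∷ʳ-suc p (suc k) b p<b b<k+p+1 with m≤n⇒m<n∨m≡n (≤-pred b<k+p+1)
... | inj₁ b<k+p = begin
  suc (k + p) ∷ (run p k ++ [ suc b ])  ≈⟨ ≈-++ˡ [ suc (k + p) ] (run-∷ʳ-suc p k b p<b b<k+p) ⟩
  suc (k + p) ∷ b ∷ run p k             ≈⟨ far-swap (run p k) (inj₂ (s≤s b<k+p)) ⟩
  b ∷ suc (k + p) ∷ run p k             ∎
  where open ≈-Reasoning
run-∷ʳ-suc p (suc zero) b p<b _ | inj₂ refl = ⊥-elim (<-irrefl refl p<b)
run-∷ʳ-suc p (suc (suc k)) b _ _ | inj₂ refl = begin
  suc b ∷ b ∷ (run p k ++ [ suc b ])  ≈⟨ ≈-++ˡ (suc b ∷ b ∷ []) (far-++∷≈∷++ (run p k) [] (run-far-above (suc b) p k ≤-refl)) ⟩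
  suc b ∷ b ∷ suc b ∷ run p k ++ []  ≈⟨ ≈-sym (≈-braid [] (run p k ++ []) b (suc b) refl) ⟩
  b ∷ suc b ∷ b ∷ run p k ++ []      ≡⟨ cong (λ w → b ∷ suc b ∷ b ∷ w) (++-identityʳ (run p k)) ⟩
  b ∷ suc b ∷ b ∷ run p k            ∎
  where open ≈-Reasoning

run-shift : ∀ m X → All (λ b → 0 < b × b < m) X → X ++ run 0 m ≈ run 0 m ++ map suc X
run-shift m [] [] = ≈-subst refl (sym (++-identityʳ _)) ≈-refl
run-shift m (b ∷ X) ((0<b , b<m) ∷ hs) = begin
  b ∷ X ++ run 0 m                ≈⟨ ≈-++ˡ [ b ] (run-shift m X hs) ⟩
  b ∷ run 0 m ++ map suc X        ≈⟨ ≈-++ʳ (map suc X) (≈-sym (run-∷ʳ-suc 0 m b 0<b (subst (b <_) (sym (+-identityʳ m)) b<m))) ⟩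
  (run 0 m ++ [ suc b ]) ++ map suc X  ≡⟨ ++-assoc (run 0 m) [ suc b ] (map suc X) ⟩
  run 0 m ++ map suc (b ∷ X)      ∎
  where open ≈-Reasoning

run-exchange : ∀ p k → suc (k + p) ∷ (run p k ++ run (suc p) k) ≈ run p k ++ run p (suc k)
run-exchange p zero = ≈-refl
run-exchange p (suc k) = begin
  suc a ∷ a ∷ (run p k ++ suc (k + suc p) ∷ run (suc p) k)  ≡⟨ cong (λ x → suc a ∷ a ∷ (run p k ++ suc x ∷ run (suc p) k)) (+-suc k p) ⟩
  suc a ∷ a ∷ (run p k ++ suc a ∷ run (suc p) k)  ≈⟨ ≈-++ˡ (suc a ∷ a ∷ []) (far-++∷≈∷++ (run p k) _ (run-far-above (suc a) p k ≤-refl)) ⟩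
  suc a ∷ a ∷ suc a ∷ (run p k ++ run (suc p) k)  ≈⟨ ≈-sym (≈-braid [] _ a (suc a) refl) ⟩
  a ∷ suc a ∷ a ∷ (run p k ++ run (suc p) k)      ≈⟨ ≈-++ˡ (a ∷ suc a ∷ []) (run-exchange p k) ⟩
  a ∷ suc a ∷ (run p k ++ a ∷ run p k)            ≈⟨ ≈-sym (≈-++ˡ [ a ] (far-++∷≈∷++ (run p k) _ (run-far-above (suc a) p k ≤-refl))) ⟩
  a ∷ (run p k ++ suc a ∷ a ∷ run p k)            ∎
  where
  open ≈-Reasoning
  a = suc (k + p)

run-exchange-gap : ∀ q e k →
  suc (k + (e + q)) ∷ (run q (k + e) ++ run (suc (e + q)) k) ≈ run (e + q) k ++ run q (suc k + e)
run-exchange-gap q e k = begin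
  a ∷ (run q (k + e) ++ Y)      ≡⟨ cong (λ w → a ∷ (w ++ Y)) (run-+ q k e) ⟩
  a ∷ ((X ++ Z) ++ Y)           ≡⟨ cong (a ∷_) (++-assoc X Z Y) ⟩
  a ∷ (X ++ (Z ++ Y))           ≈⟨ ≈-++ˡ (a ∷ X) (far-blocks-commute Z Y Z-far-Y) ⟩
  a ∷ (X ++ (Y ++ Z))           ≡⟨ cong (a ∷_) (++-assoc X Y Z) ⟨
  (a ∷ (X ++ Y)) ++ Z           ≈⟨ ≈-++ʳ Z (run-exchange q' k) ⟩
  (X ++ run q' (suc k)) ++ Z    ≡⟨ ++-assoc X _ Z ⟩
  X ++ (run q' (suc k) ++ Z)    ≡⟨ cong (X ++_) (run-+ q (suc k) e) ⟨
  X ++ run q (suc k + e)        ∎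
  where
  open ≈-Reasoning
  q' = e + q
  a = suc (k + q')
  X = run q' k
  Y = run (suc q') k
  Z = run q e
  Z-far-Y : All (λ z → All (Far z) Y) Z
  Z-far-Y = All-run q e (λ _ _ z≤ → All-run (suc q') k (λ _ y> _ → inj₁ (≤-trans (s≤s (s≤s z≤)) y>)))

run-exchange-code : ∀ q q' m → q ≤ q' → q' ≤ m →
  suc m ∷ (run q (m ∸ q) ++ run (suc q') (m ∸ q')) ≈ run q' (m ∸ q') ++ run q (suc m ∸ q)
run-exchange-code q q' m q≤q' q'≤m = ≈-subst lhs rhs (run-exchange-gap q e k)
  where
  e = q' ∸ q
  k = m ∸ q'
  e+q≡q' : e + q ≡ q'
  e+q≡q' = m∸n+n≡m q≤q'
  k+e≡m∸q : k + e ≡ m ∸ q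
  k+e≡m∸q = trans (sym (+-∸-assoc k q≤q')) (cong (_∸ q) (m∸n+n≡m q'≤m))
  lhs : suc (k + (e + q)) ∷ (run q (k + e) ++ run (suc (e + q)) k) ≡ suc m ∷ (run q (m ∸ q) ++ run (suc q') k)
  lhs = cong₂ _∷_ (cong suc (trans (cong (k +_) e+q≡q') (m∸n+n≡m q'≤m)))
                  (cong₂ _++_ (cong (run q) k+e≡m∸q) (cong (λ z → run (suc z) k) e+q≡q'))
  rhs : run (e + q) k ++ run q (suc k + e) ≡ run q' k ++ run q (suc m ∸ q)
  rhs = cong₂ _++_ (cong (λ z → run z k) e+q≡q')
                   (cong (run q) (trans (cong suc k+e≡m∸q) (sym (+-∸-assoc 1 (≤-trans q≤q' q'≤m)))))

-- Braid words acting on lists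

swapAt : ∀ {A : Set} → ℕ → List A → List A
swapAt zero (x ∷ y ∷ l) = y ∷ x ∷ l
swapAt zero l = l
swapAt (suc k) [] = []
swapAt (suc k) (x ∷ l) = x ∷ swapAt k l

-- σ_k swaps the entries at positions k - 1 and k; the non-generator σ_0 acts trivially.
actLetter : ∀ {A : Set} → ℕ → List A → List A
actLetter zero l = l
actLetter (suc k) l = swapAt k l

act : ∀ {A : Set} → Word → List A → List A
act [] l = l
act (a ∷ w) l = act w (actLetter a l)

act-++ : ∀ {A : Set} u v (l : List A) → act (u ++ v) l ≡ act v (act u l)
act-++ [] v l = refl
act-++ (a ∷ u) v l = act-++ u v (actLetter a l)

length-swapAt : ∀ {A : Set} k (l : List A) → length (swapAt k l) ≡ length l
length-swapAt zero [] = refl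
length-swapAt zero (x ∷ []) = refl
length-swapAt zero (x ∷ y ∷ l) = refl
length-swapAt (suc k) [] = refl
length-swapAt (suc k) (x ∷ l) = cong suc (length-swapAt k l)

length-actLetter : ∀ {A : Set} k (l : List A) → length (actLetter k l) ≡ length l
length-actLetter zero l = refl
length-actLetter (suc k) l = length-swapAt k l

length-act : ∀ {A : Set} w (l : List A) → length (act w l) ≡ length l
length-act [] l = refl
length-act (a ∷ w) l = trans (length-act w (actLetter a l)) (length-actLetter a l)

swapAt-comm : ∀ {A : Set} k k' (l : List A) → suc (suc k) ≤ k' → swapAt k (swapAt k' l) ≡ swapAt k' (swapAt k l)
swapAt-comm zero (suc (suc k')) [] h = refl
swapAt-comm zero (suc (suc k')) (x ∷ []) h = refl
swapAt-comm zero (suc (suc k')) (x ∷ y ∷ l) h = refl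
swapAt-comm zero (suc zero) l (s≤s ())
swapAt-comm (suc k) (suc k') [] h = refl
swapAt-comm (suc k) (suc k') (x ∷ l) (s≤s h) = cong (x ∷_) (swapAt-comm k k' l h)

swapAt-braid : ∀ {A : Set} k (l : List A) → suc (suc k) < length l → swapAt k (swapAt (suc k) (swapAt k l)) ≡ swapAt (suc k) (swapAt k (swapAt (suc k) l))
swapAt-braid zero (x ∷ y ∷ z ∷ l) h = refl
swapAt-braid zero (x ∷ []) (s≤s ())
swapAt-braid zero (x ∷ y ∷ []) (s≤s (s≤s ()))
swapAt-braid (suc k) (x ∷ l) (s≤s h) = cong (x ∷_) (swapAt-braid k l h)

act-resp-≈ : ∀ {A : Set} {u v} → u ≈ v → (l : List A) → Valid (length l) u → act u l ≡ act v l
act-resp-≈ ≈-refl l p = refl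
act-resp-≈ (≈-sym q) l p = sym (act-resp-≈ q l (All-resp-≈⁻ q p))
act-resp-≈ (≈-trans q r) l p = trans (act-resp-≈ q l p) (act-resp-≈ r l (All-resp-≈ q p))
act-resp-≈ (≈-comm u v i j h) l p =
  trans (act-++ u (i ∷ j ∷ v) l) (trans (cong (act v) (letters-commute i j h)) (sym (act-++ u (j ∷ i ∷ v) l)))
  where
  letters-commute : ∀ i j → suc (suc i) ≤ j → actLetter j (actLetter i (act u l)) ≡ actLetter i (actLetter j (act u l))
  letters-commute zero j h = refl
  letters-commute (suc i) (suc j) (s≤s h) = sym (swapAt-comm i j (act u l) h)
act-resp-≈ (≈-braid u v i j refl) l p with ++⁻ʳ u p
... | (0<i , _) ∷ (_ , i+1<n) ∷ _ =
  trans (act-++ u (i ∷ suc i ∷ i ∷ v) l)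
        (trans (cong (act v) (letters-braid i 0<i i+1<n)) (sym (act-++ u (suc i ∷ i ∷ suc i ∷ v) l)))
  where
  letters-braid : ∀ i → 0 < i → suc i < length l →
    actLetter i (actLetter (suc i) (actLetter i (act u l))) ≡ actLetter (suc i) (actLetter i (actLetter (suc i) (act u l)))
  letters-braid (suc i) _ h = swapAt-braid i (act u l) (subst (suc (suc i) <_) (sym (length-act u l)) h)

-- Inversions and reduced words

countBelow : ℕ → List ℕ → ℕ
countBelow x [] = 0
countBelow x (y ∷ l) = if y <ᵇ x then suc (countBelow x l) else countBelow x l

inversions : List ℕ → ℕ
inversions [] = 0
inversions (x ∷ l) = countBelow x l + inversions l

countBelow-∷-≥ : ∀ x y l → countBelow x l ≤ countBelow x (y ∷ l)
countBelow-∷-≥ x y l with y <ᵇ x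
... | true = n≤1+n _
... | false = ≤-refl

countBelow-∷-≤ : ∀ x y l → countBelow x (y ∷ l) ≤ suc (countBelow x l)
countBelow-∷-≤ x y l with y <ᵇ x
... | true = ≤-refl
... | false = n≤1+n _

countBelow-swapAt : ∀ x k l → countBelow x (swapAt k l) ≡ countBelow x l
countBelow-swapAt x zero [] = refl
countBelow-swapAt x zero (y ∷ []) = refl
countBelow-swapAt x zero (y ∷ z ∷ l) with y <ᵇ x | z <ᵇ x
... | true | true = refl
... | true | false = refl
... | false | true = refl
... | false | false = refl
countBelow-swapAt x (suc k) [] = refl
countBelow-swapAt x (suc k) (y ∷ l) with y <ᵇ x
... | true = cong suc (countBelow-swapAt x k l)
... | false = countBelow-swapAt x k l

inversions-swapAt : ∀ k l → inversions (swapAt k l) ≤ suc (inversions l)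
inversions-swapAt zero [] = n≤1+n _
inversions-swapAt zero (x ∷ []) = n≤1+n _
inversions-swapAt zero (x ∷ y ∷ r) = begin
  countBelow y (x ∷ r) + (countBelow x r + inversions r) ≤⟨ +-monoˡ-≤ _ (countBelow-∷-≤ y x r) ⟩
  suc (countBelow y r + (countBelow x r + inversions r)) ≡⟨ cong suc (x+[y+z]≡y+[x+z] (countBelow y r) (countBelow x r) (inversions r)) ⟩
  suc (countBelow x r + (countBelow y r + inversions r)) ≤⟨ s≤s (+-monoˡ-≤ _ (countBelow-∷-≥ x y r)) ⟩
  suc (countBelow x (y ∷ r) + (countBelow y r + inversions r)) ∎
  where open ≤-Reasoning
inversions-swapAt (suc k) [] = n≤1+n _
inversions-swapAt (suc k) (x ∷ l) = begin
  countBelow x (swapAt k l) + inversions (swapAt k l) ≡⟨ cong (_+ inversions (swapAt k l)) (countBelow-swapAt x k l) ⟩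
  countBelow x l + inversions (swapAt k l) ≤⟨ +-monoʳ-≤ (countBelow x l) (inversions-swapAt k l) ⟩
  countBelow x l + suc (inversions l) ≡⟨ +-suc _ _ ⟩
  suc (countBelow x l + inversions l) ∎
  where open ≤-Reasoning

inversions-actLetter : ∀ k l → inversions (actLetter k l) ≤ suc (inversions l)
inversions-actLetter zero l = n≤1+n _
inversions-actLetter (suc k) l = inversions-swapAt k l

inversions-act : ∀ w l → inversions (act w l) ≤ length w + inversions l
inversions-act [] l = ≤-refl
inversions-act (a ∷ w) l = begin
  inversions (act w (actLetter a l)) ≤⟨ inversions-act w (actLetter a l) ⟩
  length w + inversions (actLetter a l) ≤⟨ +-monoʳ-≤ (length w) (inversions-actLetter a l) ⟩
  length w + suc (inversions l) ≡⟨ +-suc _ _ ⟩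
  suc (length w + inversions l) ∎
  where open ≤-Reasoning

countBelow-none : ∀ x l → All (x ≤_) l → countBelow x l ≡ 0
countBelow-none x [] [] = refl
countBelow-none x (y ∷ l) (h ∷ hs) with y <ᵇ x in eq
... | true = ⊥-elim (<⇒≱ (<ᵇ⇒< y x (subst (λ b → T b) (sym eq) tt)) h)

... | false = countBelow-none x l hs

countBelow-all : ∀ x l → All (_< x) l → countBelow x l ≡ length l
countBelow-all x [] [] = refl
countBelow-all x (y ∷ l) (h ∷ hs) with y <ᵇ x in eq
... | true = cong suc (countBelow-all x l hs)
... | false = ⊥-elim (subst (λ b → T b) eq (<⇒<ᵇ h))

inversions-applyUpTo : ∀ f n → (∀ {i j} → i ≤ j → f i ≤ f j) → inversions (applyUpTo f n) ≡ 0
inversions-applyUpTo f zero mono = refl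
inversions-applyUpTo f (suc n) mono = cong₂ _+_
  (countBelow-none (f 0) _ (applyUpTo⁺₁ (f ∘ suc) n (λ _ → mono z≤n)))
  (inversions-applyUpTo (f ∘ suc) n (λ i≤j → mono (s≤s i≤j)))

inversions-upTo : ∀ n → inversions (upTo n) ≡ 0
inversions-upTo n = inversions-applyUpTo id n id

downFrom-< : ∀ n m → n ≤ m → All (_< m) (downFrom n)
downFrom-< zero m h = []
downFrom-< (suc n) m h = h ∷ downFrom-< n m (≤-trans (n≤1+n n) h)

triangle : ℕ → ℕ
triangle zero = 0
triangle (suc n) = n + triangle n

inversions-downFrom : ∀ n → inversions (downFrom n) ≡ triangle n
inversions-downFrom zero = refl
inversions-downFrom (suc n) = cong₂ _+_ (trans (countBelow-all n (downFrom n) (downFrom-< n n ≤-refl)) (length-downFrom n)) (inversions-downFrom n)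

swapAt-++ : ∀ {A : Set} k (l r : List A) → suc k < length l → swapAt k (l ++ r) ≡ swapAt k l ++ r
swapAt-++ zero (x ∷ y ∷ l) r h = refl
swapAt-++ zero (x ∷ []) r (s≤s ())
swapAt-++ (suc k) (x ∷ l) r (s≤s h) = cong (x ∷_) (swapAt-++ k l r h)

actLetter-++ : ∀ {A : Set} k (l r : List A) → k < length l → actLetter k (l ++ r) ≡ actLetter k l ++ r
actLetter-++ zero l r h = refl
actLetter-++ (suc k) l r h = swapAt-++ k l r h

act-prefix : ∀ {A : Set} w (l r : List A) → All (_< length l) w → act w (l ++ r) ≡ act w l ++ r
act-prefix [] l r [] = refl
act-prefix (a ∷ w) l r (h ∷ hs) = trans (cong (act w) (actLetter-++ a l r h))
  (act-prefix w (actLetter a l) r (subst (λ m → All (_< m) w) (sym (length-actLetter a l)) hs))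

swapAt-length : ∀ {A : Set} (a : List A) y x r → swapAt (length a) (a ++ y ∷ x ∷ r) ≡ a ++ x ∷ y ∷ r
swapAt-length [] y x r = refl
swapAt-length (z ∷ a) y x r = cong (z ∷_) (swapAt-length a y x r)

act-run : ∀ {A : Set} k (a b : List A) x r → length b ≡ k → act (run (length a) k) (a ++ b ++ x ∷ r) ≡ a ++ x ∷ b ++ r
act-run zero a [] x r _ = refl
act-run (suc k) a (y ∷ b) x r len = begin
  act (run (length a) (suc k)) (a ++ y ∷ b ++ x ∷ r)            ≡⟨ cong (λ w → act w (a ++ y ∷ b ++ x ∷ r)) (run-∷ʳ (length a) k) ⟩
  act (R ++ [ suc (length a) ]) (a ++ y ∷ b ++ x ∷ r)           ≡⟨ act-++ R _ _ ⟩
  swapAt (length a) (act R (a ++ y ∷ b ++ x ∷ r))               ≡⟨ cong (λ l → swapAt (length a) (act R l)) (++-assoc a [ y ] _) ⟨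
  swapAt (length a) (act R ((a ++ [ y ]) ++ b ++ x ∷ r))        ≡⟨ cong (λ p → swapAt (length a) (act (run p k) ((a ++ [ y ]) ++ b ++ x ∷ r))) length-a∷ʳy ⟨
  swapAt (length a) (act (run (length (a ++ [ y ])) k) ((a ++ [ y ]) ++ b ++ x ∷ r))
                                                                  ≡⟨ cong (swapAt (length a)) (act-run k (a ++ [ y ]) b x r (suc-injective len)) ⟩
  swapAt (length a) ((a ++ [ y ]) ++ x ∷ b ++ r)                ≡⟨ cong (swapAt (length a)) (++-assoc a [ y ] (x ∷ b ++ r)) ⟩
  swapAt (length a) (a ++ y ∷ x ∷ b ++ r)                       ≡⟨ swapAt-length a y x (b ++ r) ⟩
  a ++ x ∷ y ∷ b ++ r                                           ∎
  where
  open ≡-Reasoning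
  R = run (suc (length a)) k
  length-a∷ʳy : length (a ++ [ y ]) ≡ suc (length a)
  length-a∷ʳy = trans (length-++ a) (+-comm (length a) 1)

-- Codes of permutations and their canonical words

insertAt : ℕ → ℕ → List ℕ → List ℕ
insertAt zero x l = x ∷ l
insertAt (suc p) x [] = x ∷ []
insertAt (suc p) x (y ∷ l) = y ∷ insertAt p x l

insertAt≡take++drop : ∀ p x l → insertAt p x l ≡ take p l ++ x ∷ drop p l
insertAt≡take++drop zero x l = refl
insertAt≡take++drop (suc p) x [] = refl
insertAt≡take++drop (suc p) x (y ∷ l) = cong (y ∷_) (insertAt≡take++drop p x l)

length-insertAt : ∀ p x l → length (insertAt p x l) ≡ suc (length l)
length-insertAt zero x l = refl
length-insertAt (suc p) x [] = refl
length-insertAt (suc p) x (y ∷ l) = cong suc (length-insertAt p x l)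

-- A code c = p ∷ c' records where the largest strand m = length c' is inserted into the permutation of c'
-- (codePerm); codeWord c multiplies the word of c' by the run moving that strand from position m to p.
IsCode : List ℕ → Set
IsCode [] = ⊤
IsCode (p ∷ c) = p ≤ length c × IsCode c

codeWord : List ℕ → Word
codeWord [] = []
codeWord (p ∷ c) = codeWord c ++ run p (length c ∸ p)

codePerm : List ℕ → List ℕ
codePerm [] = []
codePerm (p ∷ c) = insertAt p (length c) (codePerm c)

length-codePerm : ∀ c → length (codePerm c) ≡ length c
length-codePerm [] = refl
length-codePerm (p ∷ c) = trans (length-insertAt p (length c) (codePerm c)) (cong suc (length-codePerm c))

Valid-mono : ∀ {m n} w → m ≤ n → Valid m w → Valid n w
Valid-mono w h v = All-map (λ (a , b) → a , ≤-trans b h) v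

run-valid : ∀ p m → p ≤ m → Valid (suc m) (run p (m ∸ p))
run-valid p m h = All-run p (m ∸ p) (λ x h1 h2 → ≤-trans (s≤s z≤n) h1 , s≤s (≤-trans h2 (≤-reflexive (m∸n+n≡m h))))

codeWord-valid : ∀ c → IsCode c → Valid (length c) (codeWord c)
codeWord-valid [] tt = []
codeWord-valid (p ∷ c) (h , hc) = ++⁺ (Valid-mono (codeWord c) (n≤1+n _) (codeWord-valid c hc)) (run-valid p (length c) h)

Valid⇒All< : ∀ {n} w → Valid n w → All (_< n) w
Valid⇒All< w v = All-map proj₂ v

act-codeWord : ∀ c → IsCode c → act (codeWord c) (upTo (length c)) ≡ codePerm c
act-codeWord [] tt = refl
act-codeWord (p ∷ c) (p≤m , hc) = begin
  act (codeWord c ++ R) (upTo (suc m))          ≡⟨ act-++ (codeWord c) R _ ⟩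
  act R (act (codeWord c) (upTo (suc m)))       ≡⟨ cong (λ l → act R (act (codeWord c) l)) (upTo-∷ʳ m) ⟨
  act R (act (codeWord c) (upTo m ++ [ m ]))    ≡⟨ cong (act R) (act-prefix (codeWord c) (upTo m) [ m ] letters<m) ⟩
  act R (act (codeWord c) (upTo m) ++ [ m ])    ≡⟨ cong (λ l → act R (l ++ [ m ])) (act-codeWord c hc) ⟩
  act R (codePerm c ++ [ m ])                   ≡⟨ cong (λ l → act R (l ++ [ m ])) (take++drop≡id p (codePerm c)) ⟨
  act R ((front ++ back) ++ [ m ])              ≡⟨ cong (act R) (++-assoc front back [ m ]) ⟩
  act R (front ++ back ++ [ m ])                ≡⟨ cong (λ q → act (run q (m ∸ p)) (front ++ back ++ [ m ])) length-front ⟨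
  act (run (length front) (m ∸ p)) (front ++ back ++ [ m ])
                                                ≡⟨ act-run (m ∸ p) front back m [] length-back ⟩
  front ++ m ∷ back ++ []                       ≡⟨ cong (λ l → front ++ m ∷ l) (++-identityʳ back) ⟩
  front ++ m ∷ back                             ≡⟨ insertAt≡take++drop p m (codePerm c) ⟨
  insertAt p m (codePerm c)                     ∎
  where
  open ≡-Reasoning
  m = length c
  R = run p (m ∸ p)
  front = take p (codePerm c)
  back = drop p (codePerm c)
  letters<m : All (_< length (upTo m)) (codeWord c)
  letters<m = subst (λ z → All (_< z) (codeWord c)) (sym (length-upTo m)) (Valid⇒All< (codeWord c) (codeWord-valid c hc))
  length-front : length front ≡ p
  length-front = trans (length-take p (codePerm c)) (m≤n⇒m⊓n≡m (subst (p ≤_) (sym (length-codePerm c)) p≤m))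
  length-back : length back ≡ m ∸ p
  length-back = trans (length-drop p (codePerm c)) (cong (_∸ p) (length-codePerm c))

insertAt-< : ∀ p m l → All (_< m) l → All (_< suc m) (insertAt p m l)
insertAt-< zero m l h = ≤-refl ∷ All-map (λ x → ≤-trans x (n≤1+n m)) h
insertAt-< (suc p) m [] h = ≤-refl ∷ []
insertAt-< (suc p) m (y ∷ l) (h ∷ hs) = ≤-trans h (n≤1+n m) ∷ insertAt-< p m l hs

codePerm-< : ∀ c → All (_< length c) (codePerm c)
codePerm-< [] = []
codePerm-< (p ∷ c) = insertAt-< p (length c) (codePerm c) (codePerm-< c)

insertAt-injective : ∀ p p' m l l' → All (_< m) l → All (_< m) l' → p ≤ length l → p' ≤ length l' →
          insertAt p m l ≡ insertAt p' m l' → p ≡ p' × l ≡ l'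
insertAt-injective zero zero m l l' h h' q q' e = refl , proj₂ (∷-injective e)
insertAt-injective zero (suc p') m l (y ∷ l') h (y< ∷ h') q q' e = ⊥-elim (<-irrefl (sym (proj₁ (∷-injective e))) y<)
insertAt-injective (suc p) zero m (y ∷ l) l' (y< ∷ h) h' q q' e = ⊥-elim (<-irrefl (proj₁ (∷-injective e)) y<)
insertAt-injective (suc p) (suc p') m (y ∷ l) (y' ∷ l') (_ ∷ h) (_ ∷ h') (s≤s q) (s≤s q') e
  with insertAt-injective p p' m l l' h h' q q' (proj₂ (∷-injective e))
... | refl , refl = refl , cong (_∷ l) (proj₁ (∷-injective e))

codePerm-injective : ∀ c c' → IsCode c → IsCode c' → length c ≡ length c' → codePerm c ≡ codePerm c' → c ≡ c'
codePerm-injective [] [] _ _ _ _ = refl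
codePerm-injective (p ∷ c) (p' ∷ c') (h , hc) (h' , hc') el e =
  cong₂ _∷_ (proj₁ r) (codePerm-injective c c' hc hc' el' (proj₂ r))
  where
  el' = suc-injective el
  r = insertAt-injective p p' (length c) (codePerm c) (codePerm c') (codePerm-< c) (subst (λ z → All (_< z) (codePerm c')) (sym el') (codePerm-< c'))
        (subst (p ≤_) (sym (length-codePerm c)) h) (subst (p' ≤_) (sym (length-codePerm c')) h') (trans e (cong (λ z → insertAt p' z (codePerm c')) (sym el')))

seg-cons : ∀ m → seg (suc m) ≡ 1 ∷ map suc (seg m)
seg-cons zero = refl
seg-cons (suc m) = trans (cong (_++ [ suc (suc m) ]) (seg-cons m)) (cong (1 ∷_) (sym (map-++ suc (seg m) [ suc m ])))

seg-valid : ∀ m → All (λ i → 0 < i × i < suc m) (seg m)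
seg-valid zero = []
seg-valid (suc m) = ++⁺ (All-map (λ (a , b) → a , ≤-trans b (n≤1+n _)) (seg-valid m)) ((s≤s z≤n , ≤-refl) ∷ [])

Δ-valid : ∀ m → Valid m (Δ m)
Δ-valid zero = []
Δ-valid (suc m) = ++⁺ (seg-valid m) (Valid-mono (Δ m) (n≤1+n m) (Δ-valid m))

act-map-suc : ∀ {A : Set} w (x : A) l → All (0 <_) w → act (map suc w) (x ∷ l) ≡ x ∷ act w l
act-map-suc [] x l [] = refl
act-map-suc (suc a ∷ w) x l (_ ∷ h) = act-map-suc w x (swapAt a l) h

act-seg : ∀ {A : Set} m (x : A) l → length l ≡ m → act (seg m) (x ∷ l) ≡ l ++ [ x ]
act-seg zero x [] e = refl
act-seg (suc m) x (y ∷ l) e = trans (cong (λ w → act w (x ∷ y ∷ l)) (seg-cons m))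
  (trans (act-map-suc (seg m) y (x ∷ l) (All-map proj₁ (seg-valid m))) (cong (y ∷_) (act-seg m x l (suc-injective e))))

act-Δ : ∀ {A : Set} m (l : List A) → length l ≡ m → act (Δ m) l ≡ reverse l
act-Δ zero [] e = refl
act-Δ (suc m) (x ∷ l) e = begin
  act (seg m ++ Δ m) (x ∷ l) ≡⟨ act-++ (seg m) (Δ m) (x ∷ l) ⟩
  act (Δ m) (act (seg m) (x ∷ l)) ≡⟨ cong (act (Δ m)) (act-seg m x l (suc-injective e)) ⟩
  act (Δ m) (l ++ [ x ]) ≡⟨ act-prefix (Δ m) l [ x ] (subst (λ z → All (_< z) (Δ m)) (sym (suc-injective e)) (Valid⇒All< (Δ m) (Δ-valid m))) ⟩
  act (Δ m) l ++ [ x ] ≡⟨ cong (_++ [ x ]) (act-Δ m l (suc-injective e)) ⟩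
  reverse l ++ [ x ] ≡⟨ sym (unfold-reverse x l) ⟩
  reverse (x ∷ l) ∎
  where open ≡-Reasoning

length-seg : ∀ m → length (seg m) ≡ m
length-seg zero = refl
length-seg (suc m) = trans (length-++ (seg m)) (trans (cong (_+ 1) (length-seg m)) (+-comm m 1))

length-Δ : ∀ m → length (Δ m) ≡ triangle m
length-Δ zero = refl
length-Δ (suc m) = trans (length-++ (seg m)) (cong₂ _+_ (length-seg m) (length-Δ m))

-- Every letter adds at most one inversion (inversions-act), so this says that w has minimal length.
Reduced : ℕ → Word → Set
Reduced n w = length w ≤ inversions (act w (upTo n))

Δ-reduced : ∀ n → Reduced n (Δ n)
Δ-reduced n = ≤-reflexive (begin
  length (Δ n)                      ≡⟨ length-Δ n ⟩
  triangle n                        ≡⟨ inversions-downFrom n ⟨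
  inversions (downFrom n)           ≡⟨ cong inversions (reverse-upTo n) ⟨
  inversions (reverse (upTo n))     ≡⟨ cong inversions (act-Δ n (upTo n) (length-upTo n)) ⟨
  inversions (act (Δ n) (upTo n))   ∎)
  where open ≡-Reasoning

Reduced-resp-≈ : ∀ {n u v} → u ≈ v → Valid n u → Reduced n u → Reduced n v
Reduced-resp-≈ {n} {u} e valid reduced =
  subst₂ _≤_ (length-resp-≈ e) (cong inversions (act-resp-≈ e (upTo n) (subst (λ z → Valid z u) (sym (length-upTo n)) valid))) reduced

inversions-act-upTo : ∀ n w → inversions (act w (upTo n)) ≤ length w
inversions-act-upTo n w = subst (inversions (act w (upTo n)) ≤_) (trans (cong (length w +_) (inversions-upTo n)) (+-identityʳ _)) (inversions-act w (upTo n))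

Reduced-prefix : ∀ {n} w z → Reduced n (w ++ z) → Reduced n w
Reduced-prefix {n} w z r = +-cancelˡ-≤ (length z) _ _ (begin
  length z + length w ≡⟨ +-comm (length z) _ ⟩
  length w + length z ≡⟨ sym (length-++ w) ⟩
  length (w ++ z) ≤⟨ r ⟩
  inversions (act (w ++ z) (upTo n)) ≡⟨ cong inversions (act-++ w z (upTo n)) ⟩
  inversions (act z (act w (upTo n))) ≤⟨ inversions-act z _ ⟩
  length z + inversions (act w (upTo n)) ∎)
  where open ≤-Reasoning

swapAt-involutive : ∀ {A : Set} k (l : List A) → swapAt k (swapAt k l) ≡ l
swapAt-involutive zero [] = refl
swapAt-involutive zero (x ∷ []) = refl
swapAt-involutive zero (x ∷ y ∷ l) = refl
swapAt-involutive (suc k) [] = refl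
swapAt-involutive (suc k) (x ∷ l) = cong (x ∷_) (swapAt-involutive k l)

actLetter-involutive : ∀ {A : Set} k (l : List A) → actLetter k (actLetter k l) ≡ l
actLetter-involutive zero l = refl
actLetter-involutive (suc k) l = swapAt-involutive k l

¬Reduced-square-suffix : ∀ {n} u a → Reduced n (u ++ a ∷ a ∷ []) → ⊥
¬Reduced-square-suffix {n} u a r = <-irrefl refl (≤-<-trans r (begin-strict
  inversions (act (u ++ a ∷ a ∷ []) (upTo n)) ≡⟨ cong inversions (trans (act-++ u (a ∷ a ∷ []) (upTo n)) (actLetter-involutive a _)) ⟩
  inversions (act u (upTo n)) ≤⟨ inversions-act-upTo n u ⟩
  length u <⟨ ≤-refl ⟩
  suc (length u) <⟨ ≤-refl ⟩
  suc (suc (length u)) ≡⟨ sym (trans (length-++ u) (+-comm (length u) 2)) ⟩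
  length (u ++ a ∷ a ∷ []) ∎))
  where open ≤-Reasoning

¬Reduced-square-prefix : ∀ {n} a z → Reduced n (a ∷ a ∷ z) → ⊥
¬Reduced-square-prefix {n} a z r = <-irrefl refl (≤-<-trans r (begin-strict
  inversions (act z (actLetter a (actLetter a (upTo n)))) ≡⟨ cong (λ l → inversions (act z l)) (actLetter-involutive a (upTo n)) ⟩
  inversions (act z (upTo n))                             ≤⟨ inversions-act-upTo n z ⟩
  length z                                                <⟨ n<1+n _ ⟩
  suc (length z)                                          <⟨ n<1+n _ ⟩
  suc (suc (length z))                                    ∎))
  where open ≤-Reasoning

-- Descents of canonical words

-- Which letters right-divide codeWord (p ∷ c) = codeWord c · run: σ_{p+1} is the last letter of the run,
-- σ_p cannot be, and any other σ_a moves through the run to σ_a (a < p) or σ_{a-1} (a > p + 1).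
data Position (a p : ℕ) : Set where
  just-above : a ≡ suc p → Position a p
  equal      : a ≡ p → Position a p
  below      : a < p → Position a p
  far-above  : suc p < a → Position a p

position : ∀ a p → Position a p
position a p with <-cmp a p
... | tri< a<p _ _ = below a<p
... | tri≈ _ a≡p _ = equal a≡p
... | tri> _ _ p<a with m≤n⇒m<n∨m≡n p<a
...   | inj₁ p+1<a = far-above p+1<a
...   | inj₂ p+1≡a = just-above (sym p+1≡a)

rightDescent : List ℕ → ℕ → Bool
rightDescentAt : ∀ {a p} → Position a p → List ℕ → Bool
rightDescent [] a = false
rightDescent (p ∷ c) a = rightDescentAt (position a p) c
rightDescentAt (just-above _) c = true
rightDescentAt (equal _) c = false
rightDescentAt {a} (below _) c = rightDescent c a
rightDescentAt {a} (far-above _) c = rightDescent c (a ∸ 1)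

<∸1⇒suc< : ∀ m {a} → a < m ∸ 1 → suc a < m
<∸1⇒suc< (suc m) a<m = s≤s a<m

∸≡suc∸suc : ∀ m p → p < m → m ∸ p ≡ suc (m ∸ suc p)
∸≡suc∸suc (suc m) zero h = refl
∸≡suc∸suc (suc m) (suc p) (s≤s h) = ∸≡suc∸suc m p h

swapAt-insertAt : ∀ k x l → k < length l → swapAt k (insertAt (suc k) x l) ≡ insertAt k x l
swapAt-insertAt zero x (y ∷ l) h = refl
swapAt-insertAt (suc k) x (y ∷ l) (s≤s h) = cong (y ∷_) (swapAt-insertAt k x l h)

swapAt-insertAt-before : ∀ k p x l → suc k < p → p ≤ length l → swapAt k (insertAt p x l) ≡ insertAt p x (swapAt k l)
swapAt-insertAt-before zero (suc (suc p)) x (y ∷ z ∷ l) h h' = refl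
swapAt-insertAt-before zero (suc (suc p)) x (y ∷ []) h (s≤s ())
swapAt-insertAt-before zero (suc zero) x l (s≤s ()) h'
swapAt-insertAt-before (suc k) (suc p) x (y ∷ l) (s≤s h) (s≤s h') = cong (y ∷_) (swapAt-insertAt-before k p x l h h')

swapAt-[] : ∀ {A : Set} k → swapAt {A} k [] ≡ []
swapAt-[] zero = refl
swapAt-[] (suc k) = refl

swapAt-insertAt-after : ∀ k p x l → p ≤ k → swapAt (suc k) (insertAt p x l) ≡ insertAt p x (swapAt k l)
swapAt-insertAt-after k zero x l h = refl
swapAt-insertAt-after k (suc p) x [] h rewrite swapAt-[] {ℕ} k = refl
swapAt-insertAt-after (suc k) (suc p) x (y ∷ l) (s≤s h) = cong (y ∷_) (swapAt-insertAt-after k p x l h)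

codeWord-peel : ∀ p c → p < length c → codeWord (p ∷ c) ≡ codeWord (suc p ∷ c) ++ [ suc p ]
codeWord-peel p c p<m = begin
  codeWord c ++ run p (m ∸ p)                              ≡⟨ cong (λ k → codeWord c ++ run p k) (∸≡suc∸suc m p p<m) ⟩
  codeWord c ++ run p (suc (m ∸ suc p))                    ≡⟨ cong (codeWord c ++_) (run-∷ʳ p (m ∸ suc p)) ⟩
  codeWord c ++ run (suc p) (m ∸ suc p) ++ [ suc p ]        ≡⟨ ++-assoc (codeWord c) _ _ ⟨
  (codeWord c ++ run (suc p) (m ∸ suc p)) ++ [ suc p ]      ∎
  where
  open ≡-Reasoning
  m = length c

-- Indexed by the descent bit: either σ_a already ends codeWord c, or codeWord c · σ_a is again canonical.
RightMultiplication : List ℕ → ℕ → Bool → Set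
RightMultiplication c a true  = Σ Word λ u → codeWord c ≈ u ++ [ a ]
RightMultiplication c a false = Σ (List ℕ) λ c' → IsCode c' × length c' ≡ length c ×
  codeWord c ++ [ a ] ≈ codeWord c' × codePerm c' ≡ actLetter a (codePerm c)

RightMultiplication-∷ : ∀ {p c a a'} → p ≤ length c →
  run p (length c ∸ p) ++ [ a ] ≈ a' ∷ run p (length c ∸ p) →
  actLetter a (codePerm (p ∷ c)) ≡ insertAt p (length c) (actLetter a' (codePerm c)) →
  ∀ d → RightMultiplication c a' d → RightMultiplication (p ∷ c) a d
RightMultiplication-∷ {p} {c} {a} {a'} _ pass _ true (u , w≈) = u ++ R , (begin
  codeWord c ++ R     ≈⟨ ≈-++ʳ R w≈ ⟩
  (u ++ [ a' ]) ++ R  ≡⟨ ++-assoc u [ a' ] R ⟩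
  u ++ a' ∷ R         ≈⟨ ≈-++ˡ u (≈-sym pass) ⟩
  u ++ R ++ [ a ]     ≡⟨ ++-assoc u R [ a ] ⟨
  (u ++ R) ++ [ a ]   ∎)
  where
  open ≈-Reasoning
  R = run p (length c ∸ p)
RightMultiplication-∷ {p} {c} {a} {a'} p≤m pass perm false (c' , hc' , len , w≈ , pe) =
  p ∷ c' , (subst (p ≤_) (sym len) p≤m , hc') , cong suc len , word , sym (trans perm (cong₂ (insertAt p) (sym len) (sym pe)))
  where
  R = run p (length c ∸ p)
  word : (codeWord c ++ R) ++ [ a ] ≈ codeWord c' ++ run p (length c' ∸ p)
  word = begin
    (codeWord c ++ R) ++ [ a ]  ≡⟨ ++-assoc (codeWord c) R [ a ] ⟩
    codeWord c ++ R ++ [ a ]    ≈⟨ ≈-++ˡ (codeWord c) pass ⟩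
    codeWord c ++ a' ∷ R        ≡⟨ ++-assoc (codeWord c) [ a' ] R ⟨
    (codeWord c ++ [ a' ]) ++ R ≈⟨ ≈-++ʳ R w≈ ⟩
    codeWord c' ++ R            ≡⟨ cong (λ k → codeWord c' ++ run p (k ∸ p)) (sym len) ⟩
    codeWord c' ++ run p (length c' ∸ p) ∎
    where open ≈-Reasoning

codeWord-∷ʳ : ∀ c a → IsCode c → 0 < a → a < length c → RightMultiplication c a (rightDescent c a)
codeWord-∷ʳ (p ∷ c) a (p≤m , hc) 0<a (s≤s a≤m) with position a p
... | just-above refl = _ , ≈-reflexive (codeWord-peel p c a≤m)
codeWord-∷ʳ (suc p ∷ c) a (p<m , hc) 0<a _ | equal refl =
  p ∷ c , (<⇒≤ p<m , hc) , refl , ≈-reflexive (sym (codeWord-peel p c p<m)) ,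
  sym (swapAt-insertAt p (length c) (codePerm c) (subst (p <_) (sym (length-codePerm c)) p<m))
... | below a<p = RightMultiplication-∷ p≤m (≈-sym (far-∷≈∷ʳ _ (run-far-below a p _ (s≤s a<p)))) (perm a 0<a a<p) _
                    (codeWord-∷ʳ c a hc 0<a (<-≤-trans a<p p≤m))
  where
  perm : ∀ a → 0 < a → a < p → actLetter a (insertAt p (length c) (codePerm c)) ≡ insertAt p (length c) (actLetter a (codePerm c))
  perm (suc k) _ k<p = swapAt-insertAt-before k p _ (codePerm c) k<p (subst (p ≤_) (sym (length-codePerm c)) p≤m)
codeWord-∷ʳ (p ∷ c) (suc b) (p≤m , hc) _ (s≤s b<m) | far-above (s≤s p<b) =
  RightMultiplication-∷ p≤m (run-∷ʳ-suc p _ b p<b (subst (b <_) (sym (m∸n+n≡m p≤m)) b<m)) (perm b p<b) _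
    (codeWord-∷ʳ c b hc (<-≤-trans z<s p<b) b<m)
  where
  perm : ∀ b → p < b → swapAt b (insertAt p (length c) (codePerm c)) ≡ insertAt p (length c) (actLetter b (codePerm c))
  perm (suc k) (s≤s p≤k) = swapAt-insertAt-after k p _ (codePerm c) p≤k

identityCode : ℕ → List ℕ
identityCode zero = []
identityCode (suc m) = m ∷ identityCode m

length-identityCode : ∀ m → length (identityCode m) ≡ m
length-identityCode zero = refl
length-identityCode (suc m) = cong suc (length-identityCode m)

identityCode-isCode : ∀ m → IsCode (identityCode m)
identityCode-isCode zero = tt
identityCode-isCode (suc m) = ≤-reflexive (sym (length-identityCode m)) , identityCode-isCode m

codeWord-identityCode : ∀ m → codeWord (identityCode m) ≡ []
codeWord-identityCode zero = refl
codeWord-identityCode (suc m) =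
  trans (cong₂ _++_ (codeWord-identityCode m) (cong (λ z → run m (z ∸ m)) (length-identityCode m))) (cong (run m) (n∸n≡0 m))

insertAt-length : ∀ x l → insertAt (length l) x l ≡ l ++ [ x ]
insertAt-length x [] = refl
insertAt-length x (y ∷ l) = cong (y ∷_) (insertAt-length x l)

codePerm-identityCode : ∀ m → codePerm (identityCode m) ≡ upTo m
codePerm-identityCode zero = refl
codePerm-identityCode (suc m) = begin
  insertAt m (length (identityCode m)) (codePerm (identityCode m)) ≡⟨ cong₂ (insertAt m) (length-identityCode m) (codePerm-identityCode m) ⟩
  insertAt m m (upTo m)                 ≡⟨ cong (λ z → insertAt z m (upTo m)) (sym (length-upTo m)) ⟩
  insertAt (length (upTo m)) m (upTo m) ≡⟨ insertAt-length m (upTo m) ⟩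
  upTo m ++ [ m ]                       ≡⟨ upTo-∷ʳ m ⟩
  upTo (suc m)                          ∎
  where open ≡-Reasoning

HasCode : ℕ → Word → Set
HasCode n w = Σ (List ℕ) λ c → IsCode c × length c ≡ n × w ≈ codeWord c × codePerm c ≡ act w (upTo n)

-- Induction on the word from the right: a reduced word never meets a right descent of its prefix's code.
reduced⇒hasCode : ∀ n w → Reduced n w → Valid n w → HasCode n w
reduced⇒hasCode n w = go (reverseView w)
  where
  go : ∀ {w} → Reverse w → Reduced n w → Valid n w → HasCode n w
  go [] _ _ = identityCode n , identityCode-isCode n , length-identityCode n ,
              ≈-reflexive (sym (codeWord-identityCode n)) , codePerm-identityCode n
  go (xs ∶ xs-view ∶ʳ a) r v with go xs-view (Reduced-prefix xs [ a ] r) (++⁻ˡ xs v) | ++⁻ʳ xs v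
  ... | c , hc , len , xs≈ , pe | (0<a , a<n) ∷ [] with rightDescent c a | codeWord-∷ʳ c a hc 0<a (subst (a <_) (sym len) a<n)
  ...   | true | u , w≈ = ⊥-elim (¬Reduced-square-suffix u a (Reduced-resp-≈ xsa≈ v r))
    where
    xsa≈ : xs ++ [ a ] ≈ u ++ a ∷ a ∷ []
    xsa≈ = ≈-subst refl (++-assoc u [ a ] [ a ]) (≈-++ʳ [ a ] (≈-trans xs≈ w≈))
  ...   | false | c' , hc' , len' , w≈ , pe' =
    c' , hc' , trans len' len , ≈-trans (≈-++ʳ [ a ] xs≈) w≈ ,
    trans pe' (trans (cong (actLetter a) pe) (sym (act-++ xs [ a ] (upTo n))))

topCode : ℕ → List ℕ
topCode zero = []
topCode (suc m) = 0 ∷ topCode m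

length-topCode : ∀ m → length (topCode m) ≡ m
length-topCode zero = refl
length-topCode (suc m) = cong suc (length-topCode m)

topCode-isCode : ∀ m → IsCode (topCode m)
topCode-isCode zero = tt
topCode-isCode (suc m) = z≤n , topCode-isCode m

codePerm-topCode : ∀ m → codePerm (topCode m) ≡ downFrom m
codePerm-topCode zero = refl
codePerm-topCode (suc m) = cong₂ _∷_ (length-topCode m) (codePerm-topCode m)

Valid-upTo : ∀ {n} w → Valid n w → Valid (length (upTo n)) w
Valid-upTo {n} w v = subst (λ z → Valid z w) (sym (length-upTo n)) v

codeWord-Valid : ∀ n c → IsCode c → length c ≡ n → Valid n (codeWord c)
codeWord-Valid n c hc refl = codeWord-valid c hc

codeWord-injective : ∀ n c c' → IsCode c → IsCode c' → length c ≡ n → length c' ≡ n → codeWord c ≈ codeWord c' → c ≡ c'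
codeWord-injective n c c' hc hc' refl l' e = codePerm-injective c c' hc hc' (sym l') (begin
  codePerm c                           ≡⟨ act-codeWord c hc ⟨
  act (codeWord c) (upTo n)            ≡⟨ act-resp-≈ e (upTo n) (Valid-upTo (codeWord c) (codeWord-valid c hc)) ⟩
  act (codeWord c') (upTo n)           ≡⟨ cong (λ z → act (codeWord c') (upTo z)) (sym l') ⟩
  act (codeWord c') (upTo (length c')) ≡⟨ act-codeWord c' hc' ⟩
  codePerm c'                          ∎)
  where open ≡-Reasoning

Δ≈codeWord-topCode : ∀ n → Δ n ≈ codeWord (topCode n)
Δ≈codeWord-topCode n with reduced⇒hasCode n (Δ n) (Δ-reduced n) (Δ-valid n)
... | c , hc , len , Δ≈ , pe = subst (λ z → Δ n ≈ codeWord z) c≡topCode Δ≈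
  where
  c≡topCode : c ≡ topCode n
  c≡topCode = codePerm-injective c (topCode n) hc (topCode-isCode n) (trans len (sym (length-topCode n)))
    (trans pe (trans (act-Δ n (upTo n) (length-upTo n)) (trans (reverse-upTo n) (sym (codePerm-topCode n)))))

complement : List ℕ → Word
complement [] = []
complement (p ∷ c) = run 0 p ++ map suc (complement c)

complement-valid : ∀ c → IsCode c → Valid (length c) (complement c)
complement-valid [] tt = []
complement-valid (p ∷ c) (p≤m , hc) =
  ++⁺ (All-run 0 p (λ x 0<x x≤p → 0<x , s≤s (≤-trans (≤-trans x≤p (≤-reflexive (+-identityʳ p))) p≤m)))
      (All-map⁺ (All-map (λ (0<b , b<m) → z<s , s≤s b<m) (complement-valid c hc)))

codeWord-++-complement : ∀ c → IsCode c → codeWord c ++ complement c ≈ codeWord (topCode (length c))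
codeWord-++-complement [] tt = ≈-refl
codeWord-++-complement (p ∷ c) (p≤m , hc) = begin
  (codeWord c ++ run p (m ∸ p)) ++ run 0 p ++ map suc Z  ≡⟨ ++-assoc (codeWord c) _ _ ⟩
  codeWord c ++ run p (m ∸ p) ++ run 0 p ++ map suc Z    ≡⟨ cong (codeWord c ++_) (++-assoc (run p (m ∸ p)) _ _) ⟨
  codeWord c ++ (run p (m ∸ p) ++ run 0 p) ++ map suc Z  ≡⟨ cong (λ w → codeWord c ++ w ++ map suc Z) runs ⟩
  codeWord c ++ run 0 m ++ map suc Z                     ≈⟨ ≈-++ˡ (codeWord c) (≈-sym (run-shift m Z (complement-valid c hc))) ⟩
  codeWord c ++ Z ++ run 0 m                             ≡⟨ ++-assoc (codeWord c) Z (run 0 m) ⟨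
  (codeWord c ++ Z) ++ run 0 m                           ≈⟨ ≈-++ʳ (run 0 m) (codeWord-++-complement c hc) ⟩
  codeWord (topCode m) ++ run 0 m                        ≡⟨ cong (λ z → codeWord (topCode m) ++ run 0 z) (sym (length-topCode m)) ⟩
  codeWord (topCode (suc m))                             ∎
  where
  open ≈-Reasoning
  m = length c
  Z = complement c
  runs : run p (m ∸ p) ++ run 0 p ≡ run 0 m
  runs = trans (cong (λ z → run z (m ∸ p) ++ run 0 p) (sym (+-identityʳ p)))
               (trans (sym (run-+ 0 (m ∸ p) p)) (cong (run 0) (m∸n+n≡m p≤m)))

codeWord-simple : ∀ n c → IsCode c → length c ≡ n → Simple n (codeWord c)
codeWord-simple n c hc refl = codeWord-valid c hc , complement c , complement-valid c hc ,
  ≈-trans (codeWord-++-complement c hc) (≈-sym (Δ≈codeWord-topCode n))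

simple⇒reduced : ∀ n x → Simple n x → Reduced n x
simple⇒reduced n x (_ , z , _ , x++z≈Δ) = Reduced-prefix x z (Reduced-resp-≈ (≈-sym x++z≈Δ) (Δ-valid n) (Δ-reduced n))

simple⇒hasCode : ∀ n x → Simple n x → HasCode n x
simple⇒hasCode n x s = reduced⇒hasCode n x (simple⇒reduced n x s) (proj₁ s)

codeWord-reduced : ∀ n c → IsCode c → length c ≡ n → Reduced n (codeWord c)
codeWord-reduced n c hc len = simple⇒reduced n (codeWord c) (codeWord-simple n c hc len)

¬square-suffix≈codeWord : ∀ n c u a → IsCode c → length c ≡ n → u ++ a ∷ a ∷ [] ≈ codeWord c → ⊥
¬square-suffix≈codeWord n c u a hc len u≈ =
  ¬Reduced-square-suffix u a (Reduced-resp-≈ (≈-sym u≈) (codeWord-Valid n c hc len) (codeWord-reduced n c hc len))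

¬square-prefix≈codeWord : ∀ n c u a → IsCode c → length c ≡ n → a ∷ a ∷ u ≈ codeWord c → ⊥
¬square-prefix≈codeWord n c u a hc len u≈ =
  ¬Reduced-square-prefix a u (Reduced-resp-≈ (≈-sym u≈) (codeWord-Valid n c hc len) (codeWord-reduced n c hc len))

rightDescent⇒RightDiv : ∀ n c a → IsCode c → length c ≡ n → 0 < a → a < n →
  rightDescent c a ≡ true → RightDiv n [ a ] (codeWord c)
rightDescent⇒RightDiv n c a hc refl 0<a a<n d with subst (RightMultiplication c a) d (codeWord-∷ʳ c a hc 0<a a<n)
... | u , w≈ = u , ++⁻ˡ u (All-resp-≈ w≈ (codeWord-valid c hc)) , ≈-sym w≈

RightDiv⇒rightDescent : ∀ n c a → IsCode c → length c ≡ n → 0 < a → a < n →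
  RightDiv n [ a ] (codeWord c) → rightDescent c a ≡ true
RightDiv⇒rightDescent n c a hc refl 0<a a<n (z , _ , z≈)
  with rightDescent c a | codeWord-∷ʳ c a hc 0<a a<n
... | true | _ = refl
... | false | c' , hc' , len , w≈ , _ =
  ⊥-elim (¬square-suffix≈codeWord n c' z a hc' len (≈-subst (++-assoc z [ a ] [ a ]) refl (≈-trans (≈-++ʳ [ a ] z≈) w≈)))

leftDescent : List ℕ → ℕ → Bool
leftDescent [] a = false
leftDescent (p ∷ []) a = false
leftDescent (p ∷ p' ∷ c) a = if a ≡ᵇ suc (length c) then p ≤ᵇ p' else leftDescent (p' ∷ c) a

codeWord-far : ∀ c a → IsCode c → length c < a → All (Far a) (codeWord c)
codeWord-far c a hc h = All-map (λ (_ , x<) → inj₂ (≤-trans (s≤s x<) h)) (codeWord-valid c hc)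

≡ᵇ-refl : ∀ n → (n ≡ᵇ n) ≡ true
≡ᵇ-refl zero = refl
≡ᵇ-refl (suc n) = ≡ᵇ-refl n

<⇒≢ᵇ : ∀ a n → a < n → (a ≡ᵇ n) ≡ false
<⇒≢ᵇ zero (suc n) h = refl
<⇒≢ᵇ (suc a) (suc n) (s≤s h) = <⇒≢ᵇ a n h

leftDescent-∷ : ∀ p c' a → a < length c' → leftDescent (p ∷ c') a ≡ leftDescent c' a
leftDescent-∷ p (p' ∷ c) a h rewrite <⇒≢ᵇ a (suc (length c)) h = refl

leftDescent-top : ∀ p p' c {a} → a ≡ suc (length c) → leftDescent (p ∷ p' ∷ c) a ≡ (p ≤ᵇ p')
leftDescent-top p p' c refl rewrite ≡ᵇ-refl (length c) = refl

LeftMultiplication : List ℕ → ℕ → Bool → Set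
LeftMultiplication c a true  = Σ (List ℕ) λ c' → IsCode c' × length c' ≡ length c × codeWord c ≈ a ∷ codeWord c'
LeftMultiplication c a false = Σ (List ℕ) λ c' → IsCode c' × length c' ≡ length c × a ∷ codeWord c ≈ codeWord c'

LeftMultiplication-∷ : ∀ {c a} p → p ≤ length c → ∀ d → LeftMultiplication c a d → LeftMultiplication (p ∷ c) a d
LeftMultiplication-∷ {c} {a} p p≤m true (c' , hc' , len , w≈) =
  p ∷ c' , (subst (p ≤_) (sym len) p≤m , hc') , cong suc len ,
  ≈-subst refl (cong (λ k → a ∷ codeWord c' ++ run p (k ∸ p)) (sym len)) (≈-++ʳ (run p (length c ∸ p)) w≈)
LeftMultiplication-∷ {c} {a} p p≤m false (c' , hc' , len , w≈) =
  p ∷ c' , (subst (p ≤_) (sym len) p≤m , hc') , cong suc len ,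
  ≈-subst refl (cong (λ k → codeWord c' ++ run p (k ∸ p)) (sym len)) (≈-++ʳ (run p (length c ∸ p)) w≈)

-- σ_{m+1} commutes with codeWord c, so it only meets the last two runs, where run-exchange-code applies.
σ-top-∷-codeWord : ∀ p p' c → IsCode c → let m = length c in
  suc m ∷ codeWord (p ∷ p' ∷ c) ≈ codeWord c ++ suc m ∷ (run p' (m ∸ p') ++ run p (suc m ∸ p))
σ-top-∷-codeWord p p' c hc = ≈-subst (cong (suc (length c) ∷_) (sym (++-assoc (codeWord c) _ _))) refl
  (≈-sym (far-++∷≈∷++ (codeWord c) _ (codeWord-far c (suc (length c)) hc ≤-refl)))

codeWord-∷-top : ∀ p p' c → IsCode (p ∷ p' ∷ c) →
  LeftMultiplication (p ∷ p' ∷ c) (suc (length c)) (leftDescent (p ∷ p' ∷ c) (suc (length c)))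
codeWord-∷-top p p' c (p≤m+1 , p'≤m , hc) rewrite leftDescent-top p p' c refl with p ≤ᵇ p' in p≤ᵇp'
... | true = suc p' ∷ p ∷ c , (s≤s p'≤m , ≤-trans p≤p' p'≤m , hc) , refl , ≈-sym (begin
  suc m ∷ codeWord (suc p' ∷ p ∷ c)                          ≈⟨ σ-top-∷-codeWord (suc p') p c hc ⟩
  codeWord c ++ suc m ∷ (run p (m ∸ p) ++ run (suc p') (m ∸ p')) ≈⟨ ≈-++ˡ (codeWord c) (run-exchange-code p p' m p≤p' p'≤m) ⟩
  codeWord c ++ run p' (m ∸ p') ++ run p (suc m ∸ p)           ≡⟨ ++-assoc (codeWord c) _ _ ⟨
  codeWord (p ∷ p' ∷ c)                                        ∎)
  where
  open ≈-Reasoning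
  m = length c
  p≤p' : p ≤ p'
  p≤p' = ≤ᵇ⇒≤ p p' (subst T (sym p≤ᵇp') tt)
... | false = p' ∷ q ∷ c , (≤-trans (<⇒≤ p'<p) p≤m+1 , q≤m , hc) , refl , (begin
  suc m ∷ codeWord (p ∷ p' ∷ c)                              ≈⟨ σ-top-∷-codeWord p p' c hc ⟩
  codeWord c ++ suc m ∷ (run p' (m ∸ p') ++ run p (suc m ∸ p)) ≡⟨ cong (λ z → codeWord c ++ suc m ∷ (run p' (m ∸ p') ++ run z (suc m ∸ z))) q+1≡p ⟨
  codeWord c ++ suc m ∷ (run p' (m ∸ p') ++ run (suc q) (m ∸ q)) ≈⟨ ≈-++ˡ (codeWord c) (run-exchange-code p' q m p'≤q q≤m) ⟩
  codeWord c ++ run q (m ∸ q) ++ run p' (suc m ∸ p')           ≡⟨ ++-assoc (codeWord c) _ _ ⟨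
  codeWord (p' ∷ q ∷ c)                                        ∎)
  where
  open ≈-Reasoning
  m = length c
  p'<p : p' < p
  p'<p = ≰⇒> (λ h → subst T p≤ᵇp' (≤⇒≤ᵇ h))
  q = p ∸ 1
  q+1≡p : suc q ≡ p
  q+1≡p = trans (sym (+-∸-assoc 1 (<-≤-trans z<s p'<p))) (m+n∸m≡n 1 p)
  q≤m : q ≤ m
  q≤m = ≤-pred (subst (_≤ suc m) (sym q+1≡p) p≤m+1)
  p'≤q : p' ≤ q
  p'≤q = ≤-pred (subst (suc p' ≤_) (sym q+1≡p) p'<p)

codeWord-∷ : ∀ c a → IsCode c → 0 < a → a < length c → LeftMultiplication c a (leftDescent c a)
codeWord-∷ (p ∷ c) a (p≤m , hc) 0<a (s≤s a≤m) with m≤n⇒m<n∨m≡n a≤m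
codeWord-∷ (p ∷ []) _ _ () _ | inj₂ refl
codeWord-∷ (p ∷ p' ∷ c) _ hpc _ _ | inj₂ refl = codeWord-∷-top p p' c hpc
... | inj₁ a<m rewrite leftDescent-∷ p c a a<m = LeftMultiplication-∷ p p≤m _ (codeWord-∷ c a hc 0<a a<m)

leftDescent⇒LeftDiv : ∀ n c a → IsCode c → length c ≡ n → 0 < a → a < n →
  leftDescent c a ≡ true → LeftDiv n [ a ] (codeWord c)
leftDescent⇒LeftDiv n c a hc refl 0<a a<n d with subst (LeftMultiplication c a) d (codeWord-∷ c a hc 0<a a<n)
... | c' , hc' , len , w≈ = codeWord c' , codeWord-Valid n c' hc' len , ≈-sym w≈

LeftDiv⇒leftDescent : ∀ n c a → IsCode c → length c ≡ n → 0 < a → a < n →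
  LeftDiv n [ a ] (codeWord c) → leftDescent c a ≡ true
LeftDiv⇒leftDescent n c a hc refl 0<a a<n (z , _ , z≈) with leftDescent c a | codeWord-∷ c a hc 0<a a<n
... | true | _ = refl
... | false | c' , hc' , len , w≈ = ⊥-elim (¬square-prefix≈codeWord n c' z a hc' len (≈-trans (≈-++ˡ [ a ] z≈) w≈))

All-reverse : ∀ {Q : ℕ → Set} l → All Q l → All Q (reverse l)
All-reverse [] [] = []
All-reverse {Q} (x ∷ l) (h ∷ hs) = subst (All Q) (sym (unfold-reverse x l)) (++⁺ (All-reverse l hs) (h ∷ []))

-- Induction from the right: reverse (xs ∷ʳ a) = a ∷ reverse xs, and σ_a cannot be a left divisor of
-- the code of reverse xs, since otherwise xs ∷ʳ a would end in σ_a σ_a.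
Reduced-reverse : ∀ n w → Reduced n w → Valid n w → Reduced n (reverse w)
Reduced-reverse n w = go (reverseView w)
  where
  go : ∀ {w} → Reverse w → Reduced n w → Valid n w → Reduced n (reverse w)
  go [] r v = r
  go (xs ∶ xs-view ∶ʳ a) r v with ++⁻ʳ xs v
  ... | (0<a , a<n) ∷ [] with reduced⇒hasCode n (reverse xs) (go xs-view (Reduced-prefix xs [ a ] r) (++⁻ˡ xs v)) (All-reverse xs (++⁻ˡ xs v))
  ... | e , he , len , rxs≈ , _ with leftDescent e a | codeWord-∷ e a he 0<a (subst (a <_) (sym len) a<n)
  ... | false | e' , he' , len' , w≈ =
    subst (Reduced n) (sym (reverse-++ xs [ a ]))
      (Reduced-resp-≈ (≈-sym (≈-trans (≈-++ˡ [ a ] rxs≈) w≈)) (codeWord-Valid n e' he' (trans len' len)) (codeWord-reduced n e' he' (trans len' len)))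
  ... | true | e' , he' , len' , w≈ = ⊥-elim (¬Reduced-square-suffix (reverse (codeWord e')) a (Reduced-resp-≈ xsa≈ v r))
    where
    xs≈ : xs ≈ reverse (codeWord e') ++ [ a ]
    xs≈ = ≈-subst (reverse-involutive xs) (unfold-reverse a (codeWord e')) (≈-reverse (≈-trans rxs≈ w≈))
    xsa≈ : xs ++ [ a ] ≈ reverse (codeWord e') ++ a ∷ a ∷ []
    xsa≈ = ≈-subst refl (++-assoc (reverse (codeWord e')) [ a ] [ a ]) (≈-++ʳ [ a ] xs≈)

reverse-codeWord-simple : ∀ n d → IsCode d → length d ≡ n → Simple n (reverse (codeWord d))
reverse-codeWord-simple n d hd len
  with reduced⇒hasCode n (reverse (codeWord d)) (Reduced-reverse n (codeWord d) (codeWord-reduced n d hd len) (codeWord-Valid n d hd len)) valid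
  where valid = All-reverse (codeWord d) (codeWord-Valid n d hd len)
... | e , he , len' , rw≈ , _ with codeWord-simple n e he len'
... | _ , z , vz , z≈ = All-reverse (codeWord d) (codeWord-Valid n d hd len) , z , vz , ≈-trans (≈-++ʳ z rw≈) z≈

RightDiv-reverse⇒leftDescent : ∀ n d a → IsCode d → length d ≡ n → 0 < a → a < n →
  RightDiv n [ a ] (reverse (codeWord d)) → leftDescent d a ≡ true
RightDiv-reverse⇒leftDescent n d a hd len 0<a a<n (z , vz , z≈) = LeftDiv⇒leftDescent n d a hd len 0<a a<n
  (reverse z , All-reverse z vz , ≈-subst (reverse-++ z [ a ]) (reverse-involutive (codeWord d)) (≈-reverse z≈))

leftDescent⇒RightDiv-reverse : ∀ n d a → IsCode d → length d ≡ n → 0 < a → a < n →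
  leftDescent d a ≡ true → RightDiv n [ a ] (reverse (codeWord d))
leftDescent⇒RightDiv-reverse n d a hd len 0<a a<n e with leftDescent⇒LeftDiv n d a hd len 0<a a<n e
... | z , vz , z≈ = reverse z , All-reverse z vz , ≈-subst (unfold-reverse a z) refl (≈-reverse z≈)

-- The codes of the second and third factors

rightDescent-just-above : ∀ p c → rightDescent (p ∷ c) (suc p) ≡ true
rightDescent-just-above p c with position (suc p) p
... | just-above _ = refl
... | equal e = ⊥-elim (<-irrefl (sym e) (n<1+n p))
... | below h = ⊥-elim (<-asym h (n<1+n p))
... | far-above h = ⊥-elim (<-irrefl refl h)

rightDescent-equal : ∀ p c → rightDescent (p ∷ c) p ≡ false
rightDescent-equal p c with position p p
... | just-above e = ⊥-elim (<-irrefl e (n<1+n p))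
... | equal _ = refl
... | below h = ⊥-elim (<-irrefl refl h)
... | far-above h = ⊥-elim (<-asym h (n<1+n p))

rightDescent-below : ∀ p c a → a < p → rightDescent (p ∷ c) a ≡ rightDescent c a
rightDescent-below p c a h with position a p
... | just-above refl = ⊥-elim (<-asym h (n<1+n p))
... | equal refl = ⊥-elim (<-irrefl refl h)
... | below _ = refl
... | far-above h' = ⊥-elim (<-asym h (<-trans (n<1+n p) h'))

rightDescent-far-above : ∀ p c a → suc p < a → rightDescent (p ∷ c) a ≡ rightDescent c (a ∸ 1)
rightDescent-far-above p c a h with position a p
... | just-above refl = ⊥-elim (<-irrefl refl h)
... | equal refl = ⊥-elim (<-asym h (n<1+n p))
... | below h' = ⊥-elim (<-asym h' (<-trans (n<1+n p) h))
... | far-above _ = refl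

rightDescent-0∷ : ∀ c a → 0 < a → rightDescent (0 ∷ c) (suc a) ≡ rightDescent c a
rightDescent-0∷ c a 0<a = rightDescent-far-above 0 c (suc a) (s≤s 0<a)

rightDescent-topCode : ∀ m a → 0 < a → a < m → rightDescent (topCode m) a ≡ true
rightDescent-topCode (suc m) (suc zero) _ _ = rightDescent-just-above 0 (topCode m)
rightDescent-topCode (suc m) (suc (suc a)) _ (s≤s a+1<m) =
  trans (rightDescent-0∷ (topCode m) (suc a) z<s) (rightDescent-topCode m (suc a) z<s a+1<m)

leftDescent-topCode : ∀ m a → 0 < a → a < m → leftDescent (topCode m) a ≡ true
leftDescent-topCode (suc m) a 0<a (s≤s a≤m) with m≤n⇒m<n∨m≡n a≤m
... | inj₁ a<m = trans (leftDescent-∷ 0 (topCode m) a (subst (a <_) (sym (length-topCode m)) a<m)) (leftDescent-topCode m a 0<a a<m)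
leftDescent-topCode (suc (suc m)) _ _ _ | inj₂ refl = leftDescent-top 0 0 (topCode m) (cong suc (sym (length-topCode m)))

-- The codes of the simple braids x with D_R(x) ⊇ D_L(Δ_{r+j}) = {1, …, r+j-1} (see code₃-complete).
code₃ : ℕ → ℕ → List ℕ
code₃ zero j = j ∷ topCode j
code₃ (suc r) j = 0 ∷ code₃ r j

length-code₃ : ∀ r j → length (code₃ r j) ≡ r + suc j
length-code₃ zero j = cong suc (length-topCode j)
length-code₃ (suc r) j = cong suc (length-code₃ r j)

code₃-isCode : ∀ r j → IsCode (code₃ r j)
code₃-isCode zero j = ≤-reflexive (sym (length-topCode j)) , topCode-isCode j
code₃-isCode (suc r) j = z≤n , code₃-isCode r j

rightDescent-code₃ : ∀ r j a → 0 < a → a < r + j → rightDescent (code₃ r j) a ≡ true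
rightDescent-code₃ zero j a 0<a a<j = trans (rightDescent-below j (topCode j) a a<j) (rightDescent-topCode j a 0<a a<j)
rightDescent-code₃ (suc r) j (suc zero) _ _ = rightDescent-just-above 0 (code₃ r j)
rightDescent-code₃ (suc r) j (suc (suc a)) _ (s≤s a+1<r+j) =
  trans (rightDescent-0∷ (code₃ r j) (suc a) z<s) (rightDescent-code₃ r j (suc a) z<s a+1<r+j)

leftDescent-code₃ : ∀ r j a → 0 < a → a < r + suc j → a ≢ j → leftDescent (code₃ r j) a ≡ true
leftDescent-code₃ zero zero a 0<a (s≤s a≤0) _ = ⊥-elim (<-irrefl refl (<-≤-trans 0<a a≤0))
leftDescent-code₃ zero (suc j) a 0<a (s≤s a≤j+1) a≢j+1 with m≤n⇒m<n∨m≡n a≤j+1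
... | inj₁ a<j+1 = trans (leftDescent-∷ (suc j) (topCode (suc j)) a (subst (a <_) (sym (length-topCode (suc j))) a<j+1))
                         (leftDescent-topCode (suc j) a 0<a a<j+1)
... | inj₂ refl = ⊥-elim (a≢j+1 refl)
leftDescent-code₃ (suc r) j a 0<a (s≤s a≤r+j+1) a≢j with m≤n⇒m<n∨m≡n a≤r+j+1
... | inj₁ a<r+j+1 = trans (leftDescent-∷ 0 (code₃ r j) a (subst (a <_) (sym (length-code₃ r j)) a<r+j+1))
                           (leftDescent-code₃ r j a 0<a a<r+j+1 a≢j)
... | inj₂ refl = top r
  where
  top : ∀ r → leftDescent (0 ∷ code₃ r j) (r + suc j) ≡ true
  top zero = leftDescent-top 0 j (topCode j) (cong suc (sym (length-topCode j)))
  top (suc r) = leftDescent-top 0 0 (code₃ r j) (cong suc (sym (length-code₃ r j)))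

leftDescent-code₃-gap : ∀ r j → 0 < j → leftDescent (code₃ r j) j ≡ false
leftDescent-code₃-gap zero (suc j) _ = leftDescent-top (suc j) 0 (topCode j) (cong suc (sym (length-topCode j)))
leftDescent-code₃-gap (suc r) j 0<j =
  trans (leftDescent-∷ 0 (code₃ r j) j (subst (j <_) (sym (length-code₃ r j)) (≤-trans (n<1+n j) (m≤n+m (suc j) r))))
        (leftDescent-code₃-gap r j 0<j)

private
  code₃-head-mismatch : ∀ j r j' → j ≡ suc (r + j') → code₃ zero j ≢ code₃ (suc r) j'
  code₃-head-mismatch _ _ _ refl ()

code₃-injective : ∀ r j r' j' → code₃ r j ≡ code₃ r' j' → r + j ≡ r' + j' → j ≡ j'
code₃-injective zero j zero j' e _ = ∷-injectiveˡ e
code₃-injective (suc r) j (suc r') j' e l = code₃-injective r j r' j' (∷-injectiveʳ e) (suc-injective l)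
code₃-injective zero j (suc r') j' e l = ⊥-elim (code₃-head-mismatch j r' j' l e)
code₃-injective (suc r) j zero j' e l = ⊥-elim (code₃-head-mismatch j' r j (sym l) (sym e))

ones : List Bool → ℕ
ones [] = 0
ones (true ∷ s) = suc (ones s)
ones (false ∷ s) = ones s

ones≤length : ∀ s → ones s ≤ length s
ones≤length [] = z≤n
ones≤length (true ∷ s) = s≤s (ones≤length s)
ones≤length (false ∷ s) = ≤-trans (ones≤length s) (n≤1+n _)

-- The codes of the simple braids x whose right descents include every σ_a with a ≠ j = ones s (see code₂-complete).
code₂ : List Bool → List ℕ
code₂ [] = []
code₂ (true ∷ s) = 0 ∷ code₂ s
code₂ (false ∷ s) = ones s ∷ code₂ s

length-code₂ : ∀ s → length (code₂ s) ≡ length s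
length-code₂ [] = refl
length-code₂ (true ∷ s) = cong suc (length-code₂ s)
length-code₂ (false ∷ s) = cong suc (length-code₂ s)

code₂-isCode : ∀ s → IsCode (code₂ s)
code₂-isCode [] = tt
code₂-isCode (true ∷ s) = z≤n , code₂-isCode s
code₂-isCode (false ∷ s) = subst (ones s ≤_) (sym (length-code₂ s)) (ones≤length s) , code₂-isCode s

rightDescent-code₂ : ∀ s a → 0 < a → a < length s → a ≢ ones s → rightDescent (code₂ s) a ≡ true
rightDescent-code₂ (true ∷ s) (suc zero) _ _ _ = rightDescent-just-above 0 (code₂ s)
rightDescent-code₂ (true ∷ s) (suc (suc a)) _ (s≤s a+1<m) a≢ =
  trans (rightDescent-0∷ (code₂ s) (suc a) z<s) (rightDescent-code₂ s (suc a) z<s a+1<m (a≢ ∘ cong suc))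
rightDescent-code₂ (false ∷ s) a 0<a (s≤s a≤m) a≢ with position a (ones s)
... | just-above refl = refl
... | equal a≡ = ⊥-elim (a≢ a≡)
... | below a< = rightDescent-code₂ s a 0<a (<-≤-trans a< (ones≤length s)) a≢
rightDescent-code₂ (false ∷ s) (suc a) _ (s≤s a<m) _ | far-above (s≤s j<a) =
  rightDescent-code₂ s a (<-≤-trans z<s j<a) a<m (λ a≡j → <-irrefl (sym a≡j) j<a)

false≢true : false ≢ true
false≢true ()

code₂-complete : ∀ e j → IsCode e → j ≤ length e → (∀ a → 0 < a → a < length e → a ≢ j → rightDescent e a ≡ true) →
  Σ (List Bool) λ s → length s ≡ length e × ones s ≡ j × code₂ s ≡ e
code₂-complete [] zero _ _ _ = [] , refl , refl , refl
code₂-complete (p ∷ e) j (p≤m , he) j≤m+1 descents with p ≟ j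
... | yes refl with code₂-complete e p he p≤m descents′
  where
  descents′ : ∀ a → 0 < a → a < length e → a ≢ p → rightDescent e a ≡ true
  descents′ a 0<a a<m a≢p with <-cmp a p
  ... | tri< a<p _ _ = trans (sym (rightDescent-below p e a a<p)) (descents a 0<a (≤-trans a<m (n≤1+n _)) a≢p)
  ... | tri≈ _ a≡p _ = ⊥-elim (a≢p a≡p)
  ... | tri> _ _ p<a = trans (sym (rightDescent-far-above p e (suc a) (s≤s p<a)))
                             (descents (suc a) z<s (s≤s a<m) (λ a+1≡p → <-irrefl (sym a+1≡p) (≤-trans p<a (n≤1+n a))))
...   | s , len , ones≡ , code≡ = false ∷ s , cong suc len , ones≡ , cong₂ _∷_ ones≡ code≡
code₂-complete (suc p ∷ e) j (p<m , _) _ descents | no p≢j =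
  ⊥-elim (false≢true (trans (sym (rightDescent-equal (suc p) e)) (descents (suc p) z<s (s≤s p<m) p≢j)))
code₂-complete (zero ∷ e) zero _ _ _ | no 0≢0 = ⊥-elim (0≢0 refl)
code₂-complete (zero ∷ e) (suc j) (_ , he) (s≤s j≤m) descents | no _ with code₂-complete e j he j≤m descents′
  where
  descents′ : ∀ a → 0 < a → a < length e → a ≢ j → rightDescent e a ≡ true
  descents′ a 0<a a<m a≢j = trans (sym (rightDescent-0∷ e a 0<a)) (descents (suc a) z<s (s≤s a<m) (a≢j ∘ suc-injective))
... | s , len , ones≡ , code≡ = true ∷ s , cong suc len , cong suc ones≡ , cong (0 ∷_) code≡

topCode-complete : ∀ e → IsCode e → (∀ a → 0 < a → a < length e → rightDescent e a ≡ true) → e ≡ topCode (length e)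
topCode-complete [] _ _ = refl
topCode-complete (zero ∷ e) (_ , he) descents = cong (0 ∷_) (topCode-complete e he descents′)
  where
  descents′ : ∀ a → 0 < a → a < length e → rightDescent e a ≡ true
  descents′ a 0<a a<m = trans (sym (rightDescent-0∷ e a 0<a)) (descents (suc a) z<s (s≤s a<m))
topCode-complete (suc p ∷ e) (p<m , _) descents =
  ⊥-elim (false≢true (trans (sym (rightDescent-equal (suc p) e)) (descents (suc p) z<s (s≤s p<m))))

code₃-complete : ∀ e → IsCode e → 0 < length e → (∀ a → 0 < a → a < length e ∸ 1 → rightDescent e a ≡ true) →
  Σ ℕ λ r → Σ ℕ λ j → e ≡ code₃ r j
code₃-complete (zero ∷ []) _ _ _ = 0 , 0 , refl
code₃-complete (zero ∷ e@(_ ∷ _)) (_ , he) _ descents with code₃-complete e he z<s descents′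
  where
  descents′ : ∀ a → 0 < a → a < length e ∸ 1 → rightDescent e a ≡ true
  descents′ a 0<a a<m-1 = trans (sym (rightDescent-0∷ e a 0<a)) (descents (suc a) z<s (<∸1⇒suc< (length e) a<m-1))
... | r , j , e≡ = suc r , j , cong (0 ∷_) e≡
code₃-complete (suc p ∷ e) (p<m+1 , he) _ descents with m≤n⇒m<n∨m≡n p<m+1
... | inj₁ p<m = ⊥-elim (false≢true (trans (sym (rightDescent-equal (suc p) e)) (descents (suc p) z<s p<m)))
... | inj₂ p+1≡m = 0 , suc p , cong (suc p ∷_) (trans (topCode-complete e he descents′) (cong topCode (sym p+1≡m)))
  where
  descents′ : ∀ a → 0 < a → a < length e → rightDescent e a ≡ true
  descents′ a 0<a a<m = trans (sym (rightDescent-below (suc p) e a (subst (a <_) (sym p+1≡m) a<m))) (descents a 0<a a<m)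

Marked : Set
Marked = List (Bool × ℕ)

-- A marked list zips a bit string with a code.  Compatible says, pair by adjacent pair, that the left descents
-- of codeWord (code₂ marks) are left descents of codeWord entries; the former fail exactly at cuts (false, true).
isCut : Bool → Bool → Bool
isCut b b' = not b ∧ b'

Compatible : Marked → Set
Compatible [] = ⊤
Compatible (_ ∷ []) = ⊤
Compatible ((b , t) ∷ (b' , t') ∷ x) = (T (isCut b b') ⊎ t ≤ t') × Compatible ((b' , t') ∷ x)

marks : Marked → List Bool
marks = map proj₁

entries : Marked → List ℕ
entries = map proj₂

length-marks : ∀ x → length (marks x) ≡ length x
length-marks x = length-map proj₁ x

length-entries : ∀ x → length (entries x) ≡ length x
length-entries x = length-map proj₂ x

T⇒≡true : ∀ {b} → T b → b ≡ true
T⇒≡true {true} _ = refl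

leftDescent-code₂-top : ∀ b b' s → leftDescent (code₂ (b ∷ b' ∷ s)) (suc (length s)) ≡ not (isCut b b')
leftDescent-code₂-top true true s = leftDescent-top 0 0 (code₂ s) (cong suc (sym (length-code₂ s)))
leftDescent-code₂-top true false s = leftDescent-top 0 (ones s) (code₂ s) (cong suc (sym (length-code₂ s)))
leftDescent-code₂-top false true s = leftDescent-top (suc (ones s)) 0 (code₂ s) (cong suc (sym (length-code₂ s)))
leftDescent-code₂-top false false s =
  trans (leftDescent-top (ones s) (ones s) (code₂ s) (cong suc (sym (length-code₂ s)))) (T⇒≡true (≤⇒≤ᵇ (≤-refl {ones s})))

leftDescent-code₂-∷ : ∀ b s a → a < length s → leftDescent (code₂ (b ∷ s)) a ≡ leftDescent (code₂ s) a
leftDescent-code₂-∷ true s a h = leftDescent-∷ 0 (code₂ s) a (subst (a <_) (sym (length-code₂ s)) h)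
leftDescent-code₂-∷ false s a h = leftDescent-∷ (ones s) (code₂ s) a (subst (a <_) (sym (length-code₂ s)) h)

LeftDescentsIncluded : Marked → Set
LeftDescentsIncluded x = ∀ a → 0 < a → a < length x → leftDescent (code₂ (marks x)) a ≡ true → leftDescent (entries x) a ≡ true

Compatible-tail : ∀ bt y → Compatible (bt ∷ y) → Compatible y
Compatible-tail bt [] v = tt
Compatible-tail (b , t) ((b' , t') ∷ y) (_ , v) = v

leftDescent-entries-top : ∀ t t' b b' x → leftDescent (entries ((b , t) ∷ (b' , t') ∷ x)) (suc (length x)) ≡ (t ≤ᵇ t')
leftDescent-entries-top t t' b b' x = leftDescent-top t t' (entries x) (cong suc (sym (length-entries x)))

leftDescent-marks-top : ∀ t t' b b' x → leftDescent (code₂ (marks ((b , t) ∷ (b' , t') ∷ x))) (suc (length x)) ≡ not (isCut b b')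
leftDescent-marks-top t t' b b' x =
  trans (cong (leftDescent (code₂ (b ∷ b' ∷ marks x))) (cong suc (sym (length-marks x)))) (leftDescent-code₂-top b b' (marks x))

Compatible⇒LeftDescentsIncluded : ∀ x → Compatible x → LeftDescentsIncluded x
Compatible⇒LeftDescentsIncluded (bt ∷ y) v a 0<a (s≤s a≤m) d with m≤n⇒m<n∨m≡n a≤m
... | inj₁ a<m = trans (leftDescent-∷ (proj₂ bt) (entries y) a (subst (a <_) (sym (length-entries y)) a<m))
                  (Compatible⇒LeftDescentsIncluded y (Compatible-tail bt y v) a 0<a a<m
                    (trans (sym (leftDescent-code₂-∷ (proj₁ bt) (marks y) a (subst (a <_) (sym (length-marks y)) a<m))) d))
Compatible⇒LeftDescentsIncluded ((b , t) ∷ (b' , t') ∷ x) (cut-or-≤ , _) _ _ _ d | inj₂ refl =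
  trans (leftDescent-entries-top t t' b b' x) (entries-≤ cut-or-≤ (trans (sym (leftDescent-marks-top t t' b b' x)) d))
  where
  entries-≤ : T (isCut b b') ⊎ t ≤ t' → not (isCut b b') ≡ true → (t ≤ᵇ t') ≡ true
  entries-≤ (inj₂ t≤t') _ = T⇒≡true (≤⇒≤ᵇ t≤t')
  entries-≤ (inj₁ cut) no-cut with isCut b b'
  entries-≤ (inj₁ ()) _ | false
  entries-≤ (inj₁ _) () | true

LeftDescentsIncluded⇒Compatible : ∀ x → LeftDescentsIncluded x → Compatible x
LeftDescentsIncluded⇒Compatible [] _ = tt
LeftDescentsIncluded⇒Compatible (_ ∷ []) _ = tt
LeftDescentsIncluded⇒Compatible ((b , t) ∷ (b' , t') ∷ x) incl = cut-or-≤ , LeftDescentsIncluded⇒Compatible ((b' , t') ∷ x) incl′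
  where
  y = (b' , t') ∷ x
  incl′ : LeftDescentsIncluded y
  incl′ a 0<a a<m d = trans (sym (leftDescent-∷ t (entries y) a (subst (a <_) (sym (length-entries y)) a<m)))
    (incl a 0<a (≤-trans a<m (n≤1+n _)) (trans (leftDescent-code₂-∷ b (marks y) a (subst (a <_) (sym (length-marks y)) a<m)) d))
  cut-or-≤ : T (isCut b b') ⊎ t ≤ t'
  cut-or-≤ with isCut b b' in cut≡
  ... | true = inj₁ tt
  ... | false = inj₂ (≤ᵇ⇒≤ t t' (subst T (trans (sym (incl _ z<s ≤-refl (trans (leftDescent-marks-top t t' b b' x) (cong not cut≡))))
                                                   (leftDescent-entries-top t t' b b' x)) tt))

Admissible : ℕ → Marked → Set
Admissible n x = length x ≡ n × Compatible x × IsCode (entries x)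

-- Counting compatible marked lists

concatMap-unique : ∀ {A B : Set} (g : A → List B) (κ : B → A) xs → Unique xs → (∀ a → a ∈ xs → Unique (g a)) →
  (∀ a y → a ∈ xs → y ∈ g a → κ y ≡ a) → Unique (concatMap g xs)
concatMap-unique g κ [] _ _ _ = []
concatMap-unique g κ (a ∷ xs) (a∉ ∷ xs!) g! κ-correct =
  Unique-++⁺ (g! a (here refl)) (concatMap-unique g κ xs xs! (λ b b∈ → g! b (there b∈)) (λ b y b∈ → κ-correct b y (there b∈))) disjoint
  where
  disjoint : ∀ {y} → y ∈ g a × y ∈ concatMap g xs → ⊥
  disjoint {y} (y∈ga , y∈xs) with find (∈-concatMap⁻ g y∈xs)
  ... | b , b∈ , y∈gb = All-lookup a∉ b∈ (trans (sym (κ-correct a y (here refl) y∈ga)) (κ-correct b y (there b∈) y∈gb))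

length-concatMap : ∀ {A B : Set} (g : A → List B) xs c → (∀ a → length (g a) ≡ c) → length (concatMap g xs) ≡ length xs * c
length-concatMap g [] c f = refl
length-concatMap g (a ∷ xs) c f = trans (length-++ (g a)) (cong₂ _+_ (f a) (length-concatMap g xs c f))

concatBelow : ∀ {A : Set} → ℕ → (ℕ → List A) → List A
concatBelow zero g = []
concatBelow (suc N) g = concatBelow N g ++ g N

length-concatBelow : ∀ {A : Set} N (g : ℕ → List A) → length (concatBelow N g) ≡ sumBelow N (λ k → length (g k))
length-concatBelow zero g = refl
length-concatBelow (suc N) g = trans (length-++ (concatBelow N g)) (cong (_+ length (g N)) (length-concatBelow N g))

∈-concatBelow⁻ : ∀ {A : Set} N (g : ℕ → List A) {x} → x ∈ concatBelow N g → Σ ℕ (λ k → k < N × x ∈ g k)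
∈-concatBelow⁻ (suc N) g m with ∈-++⁻ (concatBelow N g) m
... | inj₁ m1 with ∈-concatBelow⁻ N g m1
...   | k , h< , mk = k , ≤-trans h< (n≤1+n N) , mk
∈-concatBelow⁻ (suc N) g m | inj₂ m2 = N , ≤-refl , m2

∈-concatBelow⁺ : ∀ {A : Set} N (g : ℕ → List A) {x} k → k < N → x ∈ g k → x ∈ concatBelow N g
∈-concatBelow⁺ (suc N) g k (s≤s h) m with m≤n⇒m<n∨m≡n h
... | inj₁ h< = ∈-++⁺ˡ (∈-concatBelow⁺ N g k h< m)
... | inj₂ refl = ∈-++⁺ʳ (concatBelow N g) m

concatBelow-unique : ∀ {A : Set} N g (κ : A → ℕ) → (∀ k → k < N → Unique (g k)) →
  (∀ k x → k < N → x ∈ g k → κ x ≡ k) → Unique (concatBelow N g)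
concatBelow-unique zero g κ _ _ = []
concatBelow-unique (suc N) g κ g! κ-correct =
  Unique-++⁺ (concatBelow-unique N g κ (λ k k<N → g! k (≤-trans k<N (n≤1+n N))) (λ k x k<N → κ-correct k x (≤-trans k<N (n≤1+n N))))
             (g! N ≤-refl) disjoint
  where
  disjoint : ∀ {x} → x ∈ concatBelow N g × x ∈ g N → ⊥
  disjoint {x} (x∈ , x∈gN) with ∈-concatBelow⁻ N g x∈
  ... | k , k<N , x∈gk = <-irrefl (trans (sym (κ-correct k x (≤-trans k<N (n≤1+n N)) x∈gk)) (κ-correct N x ≤-refl x∈gN)) k<N

take-length-++ : ∀ {A : Set} (u r : List A) → take (length u) (u ++ r) ≡ u
take-length-++ [] r = refl
take-length-++ (x ∷ u) r = cong (x ∷_) (take-length-++ u r)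

length≡0⇒[] : ∀ {A : Set} (r : List A) → length r ≡ 0 → r ≡ []
length≡0⇒[] [] _ = refl

sumBelow-cong : ∀ N f g → (∀ k → k < N → f k ≡ g k) → sumBelow N f ≡ sumBelow N g
sumBelow-cong zero f g h = refl
sumBelow-cong (suc N) f g h = cong₂ _+_ (sumBelow-cong N f g (λ k h< → h k (≤-trans h< (n≤1+n N)))) (h N ≤-refl)

Increasing : List ℕ → Set
Increasing [] = ⊤
Increasing (_ ∷ []) = ⊤
Increasing (a ∷ b ∷ l) = a ≤ b × Increasing (b ∷ l)

increasing : ℕ → ℕ → List (List ℕ)
increasing zero k = [ [] ]
increasing (suc L) zero = [ replicate (suc L) 0 ]
increasing (suc L) (suc k) = map (0 ∷_) (increasing L (suc k)) ++ map (map suc) (increasing (suc L) k)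

IncreasingBounded : ℕ → ℕ → List ℕ → Set
IncreasingBounded L k w = length w ≡ L × Increasing w × All (_≤ k) w

replicate-zero-increasingBounded : ∀ L → IncreasingBounded L 0 (replicate L 0)
replicate-zero-increasingBounded zero = refl , tt , []
replicate-zero-increasingBounded (suc zero) = refl , tt , (z≤n ∷ [])
replicate-zero-increasingBounded (suc (suc L)) with replicate-zero-increasingBounded (suc L)
... | l , i , a = cong suc l , (z≤n , i) , (z≤n ∷ a)

Increasing-0∷ : ∀ w → Increasing w → Increasing (0 ∷ w)
Increasing-0∷ [] _ = tt
Increasing-0∷ (x ∷ w) i = z≤n , i

Increasing-map-suc : ∀ w → Increasing w → Increasing (map suc w)
Increasing-map-suc [] _ = tt
Increasing-map-suc (x ∷ []) _ = tt
Increasing-map-suc (x ∷ y ∷ w) (h , i) = s≤s h , Increasing-map-suc (y ∷ w) i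

increasing-sound : ∀ L k w → w ∈ increasing L k → IncreasingBounded L k w
increasing-sound zero k .[] (here refl) = refl , tt , []
increasing-sound (suc L) zero w (here refl) = replicate-zero-increasingBounded (suc L)
increasing-sound (suc L) (suc k) w m with ∈-++⁻ (map (0 ∷_) (increasing L (suc k))) m
... | inj₁ m1 with ∈-map⁻ (0 ∷_) m1
...   | w' , m' , refl with increasing-sound L (suc k) w' m'
...     | l , i , a = cong suc l , Increasing-0∷ w' i , (z≤n ∷ a)
increasing-sound (suc L) (suc k) w m | inj₂ m2 with ∈-map⁻ (map suc) m2
...   | w' , m' , refl with increasing-sound (suc L) k w' m'
...     | l , i , a = trans (length-map suc w') l , Increasing-map-suc w' i , All-map⁺ (All-map s≤s a)

Increasing-head-≤ : ∀ a l → Increasing (a ∷ l) → All (a ≤_) l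
Increasing-head-≤ a [] _ = []
Increasing-head-≤ a (b ∷ l) (h , i) = h ∷ All-map (≤-trans h) (Increasing-head-≤ b l i)

Increasing-tail : ∀ a l → Increasing (a ∷ l) → Increasing l
Increasing-tail a [] _ = tt
Increasing-tail a (b ∷ l) (_ , i) = i

All≤0⇒replicate : ∀ w → All (_≤ 0) w → w ≡ replicate (length w) 0
All≤0⇒replicate [] [] = refl
All≤0⇒replicate (zero ∷ w) (_ ∷ a) = cong (0 ∷_) (All≤0⇒replicate w a)

Increasing-map-pred : ∀ w → Increasing w → Increasing (map (_∸ 1) w)
Increasing-map-pred [] _ = tt
Increasing-map-pred (x ∷ []) _ = tt
Increasing-map-pred (x ∷ y ∷ w) (h , i) = ∸-monoˡ-≤ 1 h , Increasing-map-pred (y ∷ w) i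

map-suc-pred : ∀ w → All (1 ≤_) w → map suc (map (_∸ 1) w) ≡ w
map-suc-pred [] [] = refl
map-suc-pred (suc x ∷ w) (_ ∷ a) = cong (suc x ∷_) (map-suc-pred w a)

increasing-complete : ∀ L k w → IncreasingBounded L k w → w ∈ increasing L k
increasing-complete zero k [] _ = here refl
increasing-complete (suc L) zero w (l , i , a) = here (trans (All≤0⇒replicate w a) (cong (λ z → replicate z 0) l))
increasing-complete (suc L) (suc k) (zero ∷ w) (l , i , (_ ∷ a)) =
  ∈-++⁺ˡ (∈-map⁺ (0 ∷_) (increasing-complete L (suc k) w (suc-injective l , Increasing-tail 0 w i , a)))
increasing-complete (suc L) (suc k) (suc x ∷ w) (l , i , a) =
  ∈-++⁺ʳ (map (0 ∷_) (increasing L (suc k))) (subst (_∈ map (map suc) (increasing (suc L) k)) (map-suc-pred (suc x ∷ w) pos)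
    (∈-map⁺ (map suc) (increasing-complete (suc L) k (map (_∸ 1) (suc x ∷ w))
      (trans (length-map (_∸ 1) (suc x ∷ w)) l , Increasing-map-pred (suc x ∷ w) i , All-map⁺ (All-map (λ h → ∸-monoˡ-≤ 1 h) a)))))
  where
  pos : All (1 ≤_) (suc x ∷ w)
  pos = s≤s z≤n ∷ All-map (≤-trans (s≤s z≤n)) (Increasing-head-≤ (suc x) w i)

increasing-unique : ∀ L k → Unique (increasing L k)
increasing-unique zero k = [] ∷ []
increasing-unique (suc L) zero = [] ∷ []
increasing-unique (suc L) (suc k) = Unique-++⁺
  (Unique-map⁺ ∷-injectiveʳ (increasing-unique L (suc k)))
  (Unique-map⁺ (map-injective suc-injective) (increasing-unique (suc L) k))
  (λ (m1 , m2) → disj m1 m2)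
  where
  disj : ∀ {x} → x ∈ map (0 ∷_) (increasing L (suc k)) → x ∈ map (map suc) (increasing (suc L) k) → ⊥
  disj m1 m2 with ∈-map⁻ (0 ∷_) m1 | ∈-map⁻ (map suc) m2
  ... | w1 , _ , refl | (y ∷ w2) , _ , ()
  ... | w1 , _ , refl | [] , m , e with increasing-sound (suc L) k [] m
  ...   | () , _

rising : ℕ → ℕ → ℕ
rising L zero = 1
rising L (suc k) = (suc k + L) * rising L k

rising-suc : ∀ L k → rising L (suc k) ≡ suc L * rising (suc L) k
rising-suc L zero = refl
rising-suc L (suc k) = begin
  (suc (suc k) + L) * rising L (suc k) ≡⟨ cong ((suc (suc k) + L) *_) (rising-suc L k) ⟩
  (suc (suc k) + L) * (suc L * rising (suc L) k) ≡⟨ sym (*-assoc (suc (suc k) + L) (suc L) _) ⟩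
  ((suc (suc k) + L) * suc L) * rising (suc L) k ≡⟨ cong (_* rising (suc L) k) (*-comm (suc (suc k) + L) (suc L)) ⟩
  (suc L * (suc (suc k) + L)) * rising (suc L) k ≡⟨ *-assoc (suc L) (suc (suc k) + L) (rising (suc L) k) ⟩
  suc L * ((suc (suc k) + L) * rising (suc L) k) ≡⟨ cong (λ z → suc L * (z * rising (suc L) k)) (cong suc (sym (+-suc k L))) ⟩
  suc L * ((suc k + suc L) * rising (suc L) k) ∎
  where open ≡-Reasoning

rising-zero : ∀ k → rising 0 k ≡ k !
rising-zero zero = refl
rising-zero (suc k) = cong₂ _*_ (cong suc (+-identityʳ k)) (rising-zero k)

length-increasing*! : ∀ L k → length (increasing L k) * k ! ≡ rising L k
length-increasing*! zero k = trans (+-identityʳ (k !)) (sym (rising-zero k))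
length-increasing*! (suc L) zero = refl
length-increasing*! (suc L) (suc k) = begin
  length (map (0 ∷_) A ++ map (map suc) B) * (suc k) !  ≡⟨ cong (_* (suc k) !) length-A+B ⟩
  (length A + length B) * (suc k) !                     ≡⟨ *-distribʳ-+ ((suc k) !) (length A) (length B) ⟩
  length A * (suc k) ! + length B * (suc k * k !)       ≡⟨ cong (length A * (suc k) ! +_) (x*[y*z]≡y*[x*z] (length B) (suc k) (k !)) ⟩
  length A * (suc k) ! + suc k * (length B * k !)       ≡⟨ cong₂ (λ x y → x + suc k * y) (length-increasing*! L (suc k)) (length-increasing*! (suc L) k) ⟩
  rising L (suc k) + suc k * rising (suc L) k           ≡⟨ cong (_+ suc k * rising (suc L) k) (rising-suc L k) ⟩
  suc L * rising (suc L) k + suc k * rising (suc L) k   ≡⟨ *-distribʳ-+ (rising (suc L) k) (suc L) (suc k) ⟨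
  (suc L + suc k) * rising (suc L) k                    ≡⟨ cong (_* rising (suc L) k) (+-comm (suc L) (suc k)) ⟩
  (suc k + suc L) * rising (suc L) k                    ∎
  where
  open ≡-Reasoning
  A = increasing L (suc k)
  B = increasing (suc L) k
  length-A+B : length (map (0 ∷_) A ++ map (map suc) B) ≡ length A + length B
  length-A+B = trans (length-++ (map (0 ∷_) A)) (cong₂ _+_ (length-map _ A) (length-map _ B))

rising*! : ∀ L k → rising L k * L ! ≡ (k + L) !
rising*! L zero = +-identityʳ (L !)
rising*! L (suc k) = trans (*-assoc (suc k + L) (rising L k) (L !)) (cong ((suc k + L) *_) (rising*! L k))

-- A compatible marked list is a sequence of blocks, each made of marked entries followed by unmarked ones
-- with weakly increasing code entries, consecutive blocks meeting at a cut.
block : ℕ → ℕ → List ℕ → Marked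
block (suc β) α (t ∷ w) = (true , t) ∷ block β α w
block zero (suc α) (t ∷ w) = (false , t) ∷ block zero α w
block _ _ _ = []

length-block : ∀ β α w → length w ≡ β + α → length (block β α w) ≡ β + α
length-block (suc β) α (t ∷ w) l = cong suc (length-block β α w (suc-injective l))
length-block zero (suc α) (t ∷ w) l = cong suc (length-block zero α w (suc-injective l))
length-block zero zero [] l = refl

entries-block : ∀ β α w → length w ≡ β + α → entries (block β α w) ≡ w
entries-block (suc β) α (t ∷ w) l = cong (t ∷_) (entries-block β α w (suc-injective l))
entries-block zero (suc α) (t ∷ w) l = cong (t ∷_) (entries-block zero α w (suc-injective l))
entries-block zero zero [] l = refl

ones-block : ∀ β α w → length w ≡ β + α → ones (marks (block β α w)) ≡ β
ones-block (suc β) α (t ∷ w) l = cong suc (ones-block β α w (suc-injective l))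
ones-block zero (suc α) (t ∷ w) l = ones-block zero α w (suc-injective l)
ones-block zero zero [] l = refl

ones-++ : ∀ s s' → ones (s ++ s') ≡ ones s + ones s'
ones-++ [] s' = refl
ones-++ (true ∷ s) s' = cong suc (ones-++ s s')
ones-++ (false ∷ s) s' = ones-++ s s'

marks-++ : ∀ u r → marks (u ++ r) ≡ marks u ++ marks r
marks-++ u r = map-++ proj₁ u r

entries-++ : ∀ u r → entries (u ++ r) ≡ entries u ++ entries r
entries-++ u r = map-++ proj₂ u r

CompatibleJoin : Marked → Marked → Set
CompatibleJoin [] r = ⊤
CompatibleJoin (e ∷ []) [] = ⊤
CompatibleJoin ((b , t) ∷ []) ((b' , t') ∷ r) = T (isCut b b') ⊎ t ≤ t'
CompatibleJoin (e ∷ e' ∷ u) r = CompatibleJoin (e' ∷ u) r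

Compatible-++ : ∀ u r → Compatible u → Compatible r → CompatibleJoin u r → Compatible (u ++ r)
Compatible-++ [] r _ vr _ = vr
Compatible-++ (e ∷ []) [] _ _ _ = tt
Compatible-++ ((b , t) ∷ []) ((b' , t') ∷ r) _ vr j = j , vr
Compatible-++ ((b , t) ∷ (b' , t') ∷ u) r (v , vu) vr j = v , Compatible-++ ((b' , t') ∷ u) r vu vr j

Compatible-suffix : ∀ u r → Compatible (u ++ r) → Compatible r
Compatible-suffix [] r v = v
Compatible-suffix (e ∷ []) [] v = tt
Compatible-suffix ((b , t) ∷ []) ((b' , t') ∷ r) (_ , v) = v
Compatible-suffix ((b , t) ∷ (b' , t') ∷ u) r (_ , v) = Compatible-suffix ((b' , t') ∷ u) r v

StartsMarked : Marked → Set
StartsMarked [] = ⊤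
StartsMarked ((b , _) ∷ _) = b ≡ true

-- What may follow a block with α unmarked entries: nothing, or a new block across a cut (false, true).
Boundary : ℕ → Marked → Set
Boundary α r = r ≡ [] ⊎ (0 < α × StartsMarked r)

Boundary-weaken : ∀ {α α' r} → 0 < α' → Boundary α r → Boundary α' r
Boundary-weaken _ (inj₁ r≡[]) = inj₁ r≡[]
Boundary-weaken 0<α' (inj₂ (_ , marked)) = inj₂ (0<α' , marked)

Boundary⇒StartsMarked : ∀ {α r} → Boundary α r → StartsMarked r
Boundary⇒StartsMarked (inj₁ refl) = tt
Boundary⇒StartsMarked (inj₂ (_ , marked)) = marked

Compatible-block : ∀ β α w → Increasing w → Compatible (block β α w)
Compatible-block (suc β) α (t ∷ []) i with β | α
... | zero | zero = tt
... | suc _ | _ = tt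
... | zero | suc _ = tt
Compatible-block (suc zero) (suc α) (t ∷ t' ∷ w) (h , i) = inj₂ h , Compatible-block zero (suc α) (t' ∷ w) i
Compatible-block (suc (suc β)) α (t ∷ t' ∷ w) (h , i) = inj₂ h , Compatible-block (suc β) α (t' ∷ w) i
Compatible-block (suc zero) zero (t ∷ t' ∷ w) (h , i) = tt
Compatible-block zero (suc zero) (t ∷ w) i = tt
Compatible-block zero (suc (suc α)) (t ∷ []) i = tt
Compatible-block zero (suc (suc α)) (t ∷ t' ∷ w) (h , i) = inj₂ h , Compatible-block zero (suc α) (t' ∷ w) i
Compatible-block zero zero w i = tt
Compatible-block (suc β) α [] i = tt
Compatible-block zero (suc α) [] i = tt

CompatibleJoin-block : ∀ β α w t' r → 0 < α → length w ≡ β + α → CompatibleJoin (block β α w) ((true , t') ∷ r)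
CompatibleJoin-block (suc zero) zero (t ∷ []) t' r () l
CompatibleJoin-block (suc zero) (suc α) (t ∷ t₂ ∷ w) t' r h l = CompatibleJoin-block zero (suc α) (t₂ ∷ w) t' r h (suc-injective l)
CompatibleJoin-block (suc (suc β)) α (t ∷ t₂ ∷ w) t' r h l = CompatibleJoin-block (suc β) α (t₂ ∷ w) t' r h (suc-injective l)
CompatibleJoin-block zero (suc zero) (t ∷ []) t' r h l = inj₁ tt
CompatibleJoin-block zero (suc (suc α)) (t ∷ t₂ ∷ w) t' r h l = CompatibleJoin-block zero (suc α) (t₂ ∷ w) t' r (s≤s z≤n) (suc-injective l)
CompatibleJoin-block (suc zero) (suc α) (t ∷ []) t' r h ()
CompatibleJoin-block zero (suc (suc α)) (t ∷ []) t' r h ()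
CompatibleJoin-block zero (suc zero) (t ∷ t₂ ∷ w) t' r h ()
CompatibleJoin-block (suc (suc β)) α (t ∷ []) t' r h ()
CompatibleJoin-block (suc zero) zero (t ∷ t₂ ∷ w) t' r h ()
CompatibleJoin-block (suc β) α [] t' r h ()
CompatibleJoin-block zero (suc α) [] t' r h ()
CompatibleJoin-block zero zero w t' r () l

IsCode-++ : ∀ w c → IsCode c → All (_≤ length c) w → IsCode (w ++ c)
IsCode-++ [] c hc [] = hc
IsCode-++ (a ∷ w) c hc (h ∷ hs) = ≤-trans h (subst (length c ≤_) (sym (length-++ w)) (m≤n+m (length c) (length w))) , IsCode-++ w c hc hs

IsCode-suffix : ∀ w c → IsCode (w ++ c) → IsCode c
IsCode-suffix [] c h = h
IsCode-suffix (a ∷ w) c (_ , h) = IsCode-suffix w c h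

IsCode-increasing-bound : ∀ w c → IsCode (w ++ c) → Increasing w → All (_≤ length c) w
IsCode-increasing-bound [] c _ _ = []
IsCode-increasing-bound (a ∷ []) c (h , _) _ = h ∷ []
IsCode-increasing-bound (a ∷ b ∷ w) c (_ , hc) (h , i) with IsCode-increasing-bound (b ∷ w) c hc i
... | hb ∷ hs = ≤-trans h hb ∷ hb ∷ hs

block-head : ∀ β α w r b' t' y → (b' , t') ∷ y ≡ block β α w ++ r → 0 < β + α → length w ≡ β + α →
           Σ (List ℕ) (λ w'' → w ≡ t' ∷ w'' × (b' ≡ true → 0 < β) × (b' ≡ false → β ≡ 0))
block-head (suc β) α (t ∷ w) r .true .t ._ refl h l = w , refl , (λ _ → s≤s z≤n) , (λ ())
block-head zero (suc α) (t ∷ w) r .false .t ._ refl h l = w , refl , (λ ()) , (λ _ → refl)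
block-head (suc β) α [] r b' t' y e h ()
block-head zero (suc α) [] r b' t' y e h ()

FirstBlock : Marked → Set
FirstBlock x = Σ ℕ λ β → Σ ℕ λ α → Σ (List ℕ) λ w → Σ Marked λ r →
  x ≡ block β α w ++ r × length w ≡ β + α × 0 < β + α × Increasing w × Boundary α r

firstBlock : ∀ x → 0 < length x → Compatible x → FirstBlock x
firstBlock ((true , t) ∷ []) _ _ = 1 , 0 , [ t ] , [] , refl , refl , s≤s z≤n , tt , inj₁ refl
firstBlock ((false , t) ∷ []) _ _ = 0 , 1 , [ t ] , [] , refl , refl , s≤s z≤n , tt , inj₁ refl
firstBlock ((false , t) ∷ (true , t') ∷ y) _ _ = 0 , 1 , [ t ] , (true , t') ∷ y , refl , refl , s≤s z≤n , tt , inj₂ (s≤s z≤n , refl)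
firstBlock ((true , t) ∷ (b' , t') ∷ y) _ (v , vs) with v | firstBlock ((b' , t') ∷ y) (s≤s z≤n) vs
... | inj₁ () | _
... | inj₂ h | β , α , w , r , e , l , p , i , j with block-head β α w r b' t' y e p l
...   | w'' , refl , hb , _ = suc β , α , t ∷ t' ∷ w'' , r , cong ((true , t) ∷_) e , cong suc l , s≤s z≤n , (h , i) , j
firstBlock ((false , t) ∷ (false , t') ∷ y) _ (v , vs) with v | firstBlock ((false , t') ∷ y) (s≤s z≤n) vs
... | inj₁ () | _
... | inj₂ h | β , α , w , r , e , l , p , i , j with block-head β α w r false t' y e p l
...   | w'' , refl , _ , hb with hb refl
...     | refl = 0 , suc α , t ∷ t' ∷ w'' , r , cong ((false , t) ∷_) e , cong suc l , s≤s z≤n , (h , i) , Boundary-weaken z<s j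

firstBlockLength : Marked → ℕ
firstBlockLength [] = 0
firstBlockLength (e ∷ []) = 1
firstBlockLength ((b , t) ∷ (b' , t') ∷ x) = if isCut b b' then 1 else suc (firstBlockLength ((b' , t') ∷ x))

firstBlockLength-marked : ∀ t z → 0 < length z → firstBlockLength ((true , t) ∷ z) ≡ suc (firstBlockLength z)
firstBlockLength-marked t ((b' , t') ∷ z) _ = refl

block-++-nonempty : ∀ β α w r → length w ≡ β + α → 0 < β + α → 0 < length (block β α w ++ r)
block-++-nonempty β α w r l p = subst (0 <_) (sym (length-++ (block β α w))) (≤-trans (subst (0 <_) (sym (length-block β α w l)) p) (m≤m+n _ _))

firstBlockLength-block : ∀ β α w r → length w ≡ β + α → 0 < β + α → Boundary α r → firstBlockLength (block β α w ++ r) ≡ β + α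
firstBlockLength-block (suc zero) zero (t ∷ []) .[] l p (inj₁ refl) = refl
firstBlockLength-block (suc zero) zero (t ∷ []) r l p (inj₂ (() , _))
firstBlockLength-block (suc zero) (suc α) (t ∷ w) r l p j =
  trans (firstBlockLength-marked t (block zero (suc α) w ++ r) (block-++-nonempty zero (suc α) w r (suc-injective l) (s≤s z≤n)))
        (cong suc (firstBlockLength-block zero (suc α) w r (suc-injective l) (s≤s z≤n) j))
firstBlockLength-block (suc (suc β)) α (t ∷ w) r l p j =
  trans (firstBlockLength-marked t (block (suc β) α w ++ r) (block-++-nonempty (suc β) α w r (suc-injective l) (s≤s z≤n)))
        (cong suc (firstBlockLength-block (suc β) α w r (suc-injective l) (s≤s z≤n) j))
firstBlockLength-block zero (suc zero) (t ∷ []) .[] l p (inj₁ refl) = refl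
firstBlockLength-block zero (suc zero) (t ∷ []) ((true , t') ∷ r) l p (inj₂ (_ , refl)) = refl
firstBlockLength-block zero (suc zero) (t ∷ []) [] l p (inj₂ _) = refl
firstBlockLength-block zero (suc (suc α)) (t ∷ t₂ ∷ w) r l p j =
  cong suc (firstBlockLength-block zero (suc α) (t₂ ∷ w) r (suc-injective l) z<s (Boundary-weaken z<s j))
firstBlockLength-block zero zero w r l () j
firstBlockLength-block (suc β) α [] r () p j
firstBlockLength-block zero (suc α) [] r () p j
firstBlockLength-block (suc zero) zero (t ∷ t₂ ∷ w) r () p j
firstBlockLength-block zero (suc zero) (t ∷ t₂ ∷ w) r () p j
firstBlockLength-block zero (suc (suc α)) (t ∷ []) r () p j

extensions : ℕ → ℕ → List ℕ → List Marked → List Marked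
extensions L k αs R = concatMap (λ α → concatMap (λ w → map (λ r → block (L ∸ α) α w ++ r) R) (increasing L k)) αs

length-extensions : ∀ L k αs R → length (extensions L k αs R) ≡ length αs * (length (increasing L k) * length R)
length-extensions L k αs R = length-concatMap _ αs _ (λ α → length-concatMap _ (increasing L k) (length R) (λ w → length-map _ R))

∈-extensions⁻ : ∀ L k αs R {x} → x ∈ extensions L k αs R →
  Σ ℕ λ α → Σ (List ℕ) λ w → Σ Marked λ r → α ∈ αs × w ∈ increasing L k × r ∈ R × x ≡ block (L ∸ α) α w ++ r
∈-extensions⁻ L k αs R x∈ with find (∈-concatMap⁻ _ x∈)
... | α , α∈ , x∈α with find (∈-concatMap⁻ _ x∈α)
... | w , w∈ , x∈αw with ∈-map⁻ _ x∈αw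
... | r , r∈ , x≡ = α , w , r , α∈ , w∈ , r∈ , x≡

∈-extensions⁺ : ∀ L k αs R {α w r} → α ∈ αs → w ∈ increasing L k → r ∈ R → block (L ∸ α) α w ++ r ∈ extensions L k αs R
∈-extensions⁺ L k αs R {α} {w} {r} ma mw mr = ∈-concatMap⁺ _ (lose ma (∈-concatMap⁺ _ (lose mw (∈-map⁺ (λ r → block (L ∸ α) α w ++ r) mr))))

take-block : ∀ L α w r → α ≤ L → length w ≡ L → take L (block (L ∸ α) α w ++ r) ≡ block (L ∸ α) α w
take-block L α w r h l = trans (cong (λ z → take z (block (L ∸ α) α w ++ r)) (sym bl)) (take-length-++ (block (L ∸ α) α w) r)
  where
  bl : length (block (L ∸ α) α w) ≡ L
  bl = trans (length-block (L ∸ α) α w (trans l (sym (m∸n+n≡m h)))) (m∸n+n≡m h)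

extensions-unique : ∀ L k αs R → Unique αs → All (_≤ L) αs → Unique R → Unique (extensions L k αs R)
extensions-unique L k αs R αs! αs≤L R! = concatMap-unique _ unmarkedOf αs αs! unique-for unmarkedOf-correct
  where
  unmarkedOf : Marked → ℕ
  unmarkedOf x = L ∸ ones (marks (take L x))
  entriesOf : Marked → List ℕ
  entriesOf x = entries (take L x)
  extend : ℕ → List ℕ → List Marked
  extend α w = map (λ r → block (L ∸ α) α w ++ r) R
  length≡ : ∀ {α w} → α ∈ αs → w ∈ increasing L k → length w ≡ (L ∸ α) + α
  length≡ α∈ w∈ = trans (proj₁ (increasing-sound L k _ w∈)) (sym (m∸n+n≡m (All-lookup αs≤L α∈)))
  prefix : ∀ {α w} r → α ∈ αs → w ∈ increasing L k → take L (block (L ∸ α) α w ++ r) ≡ block (L ∸ α) α w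
  prefix r α∈ w∈ = take-block L _ _ r (All-lookup αs≤L α∈) (proj₁ (increasing-sound L k _ w∈))
  unique-for : ∀ α → α ∈ αs → Unique (concatMap (extend α) (increasing L k))
  unique-for α α∈ = concatMap-unique (extend α) entriesOf (increasing L k) (increasing-unique L k)
    (λ w _ → Unique-map⁺ (λ e → ++-cancelˡ (block (L ∸ α) α w) _ _ e) R!) entriesOf-correct
    where
    entriesOf-correct : ∀ w y → w ∈ increasing L k → y ∈ extend α w → entriesOf y ≡ w
    entriesOf-correct w y w∈ y∈ with ∈-map⁻ _ y∈
    ... | r , _ , refl = trans (cong entries (prefix r α∈ w∈)) (entries-block (L ∸ α) α w (length≡ α∈ w∈))
  unmarkedOf-correct : ∀ α y → α ∈ αs → y ∈ concatMap (extend α) (increasing L k) → unmarkedOf y ≡ α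
  unmarkedOf-correct α y α∈ y∈ with find (∈-concatMap⁻ (extend α) y∈)
  ... | w , w∈ , y∈′ with ∈-map⁻ _ y∈′
  ... | r , _ , refl = trans (cong (λ z → L ∸ ones (marks z)) (prefix r α∈ w∈))
                             (trans (cong (L ∸_) (ones-block (L ∸ α) α w (length≡ α∈ w∈))) (m∸[m∸n]≡n (All-lookup αs≤L α∈)))

unmarkedChoices : ℕ → ℕ → ℕ
unmarkedChoices L zero = L
unmarkedChoices L (suc k) = L ∸ 1

-- rising (N ∸ k) k = N! / (N - k)!, and (L - 1) · N!/L! = N!/(L - 1)! - N!/L!: the sum telescopes.
sumBelow-telescope : ∀ N j → 0 < j → j ≤ N → sumBelow j (λ k → unmarkedChoices (N ∸ k) k * rising (N ∸ k) k) ≡ rising (N ∸ j) j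
sumBelow-telescope (suc N) (suc zero) _ _ = trans (*-identityʳ (suc N)) (cong suc (sym (*-identityʳ N)))
sumBelow-telescope N (suc (suc j)) _ h = begin
  sumBelow (suc j) F + unmarkedChoices (N ∸ suc j) (suc j) * rising (N ∸ suc j) (suc j)
    ≡⟨ cong (_+ unmarkedChoices (N ∸ suc j) (suc j) * rising (N ∸ suc j) (suc j)) (sumBelow-telescope N (suc j) (s≤s z≤n) (≤-trans (n≤1+n _) h)) ⟩
  rising (N ∸ suc j) (suc j) + ((N ∸ suc j) ∸ 1) * rising (N ∸ suc j) (suc j)
    ≡⟨ cong (λ z → rising z (suc j) + (z ∸ 1) * rising z (suc j)) NM ⟩
  rising (suc M) (suc j) + M * rising (suc M) (suc j)
    ≡⟨ sym (rising-suc M (suc j)) ⟩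
  rising M (suc (suc j)) ∎
  where
  open ≡-Reasoning
  F = λ k → unmarkedChoices (N ∸ k) k * rising (N ∸ k) k
  M = N ∸ suc (suc j)
  NM : N ∸ suc j ≡ suc M
  NM = +-∸-assoc 1 h

factQuot≡rising : ∀ n i → i ≤ n → factQuot n i ≡ rising i (n ∸ i)
factQuot≡rising n i h = trans (cong (λ z → (z / i !) {{i !≢0}}) (sym eq)) (m*n/n≡m (rising i (n ∸ i)) (i !) {{i !≢0}})
  where
  eq : rising i (n ∸ i) * i ! ≡ n !
  eq = trans (rising*! i (n ∸ i)) (cong _! (m∸n+n≡m h))

-- The possible numbers α of unmarked entries in a first block of length L that starts with a mark and is
-- followed by k entries: α < L, and α > 0 when a cut follows.
unmarkedCounts : ℕ → ℕ → List ℕ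
unmarkedCounts L zero = upTo L
unmarkedCounts L (suc _) = map suc (upTo (L ∸ 1))

-- The admissible lists of length n that are empty or start with a mark, by the number k of entries after
-- the first block; the fuel f ≥ n only makes the recursion structural.
enumStartsMarked : ℕ → ℕ → List Marked
enumStartsMarked f zero = [ [] ]
enumStartsMarked zero (suc n) = []
enumStartsMarked (suc f) (suc n) = concatBelow (suc n) (λ k → extensions (suc n ∸ k) k (unmarkedCounts (suc n ∸ k) k) (enumStartsMarked f k))

-- The admissible lists of length n with fewer than n marks, by the length i + 1 of their first block.
enumAdmissible : ℕ → List Marked
enumAdmissible n = concatBelow n (λ i → extensions (suc i) (n ∸ suc i) (map suc (upTo (suc i))) (enumStartsMarked n (n ∸ suc i)))

CompatibleJoin-[] : ∀ u → CompatibleJoin u []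
CompatibleJoin-[] [] = tt
CompatibleJoin-[] (e ∷ []) = tt
CompatibleJoin-[] (e ∷ e' ∷ u) = CompatibleJoin-[] (e' ∷ u)

block-++-admissible : ∀ L k α w r → α ≤ L → w ∈ increasing L k → Admissible k r → Boundary α r → Admissible (L + k) (block (L ∸ α) α w ++ r)
block-++-admissible L k α w r hα mw (lr , vr , cr) j =
  trans (length-++ (block (L ∸ α) α w)) (cong₂ _+_ (trans (length-block (L ∸ α) α w lw') (m∸n+n≡m hα)) lr) ,
  Compatible-++ (block (L ∸ α) α w) r (Compatible-block (L ∸ α) α w inc) vr (join j) ,
  subst IsCode (sym dseq) (IsCode-++ w (entries r) cr (All-map (λ h → subst (_ ≤_) (sym (trans (length-map proj₂ r) lr)) h) bnd))
  where
  ok = increasing-sound L k w mw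
  lw' : length w ≡ (L ∸ α) + α
  lw' = trans (proj₁ ok) (sym (m∸n+n≡m hα))
  inc = proj₁ (proj₂ ok)
  bnd = proj₂ (proj₂ ok)
  dseq : entries (block (L ∸ α) α w ++ r) ≡ w ++ entries r
  dseq = trans (entries-++ (block (L ∸ α) α w) r) (cong (_++ entries r) (entries-block (L ∸ α) α w lw'))
  join : Boundary α r → CompatibleJoin (block (L ∸ α) α w) r
  join (inj₁ refl) = CompatibleJoin-[] (block (L ∸ α) α w)
  join (inj₂ (0<α , marked)) = join-marked r 0<α marked
    where
    join-marked : ∀ r → 0 < α → StartsMarked r → CompatibleJoin (block (L ∸ α) α w) r
    join-marked [] _ _ = CompatibleJoin-[] (block (L ∸ α) α w)
    join-marked ((true , t') ∷ r') 0<α refl = CompatibleJoin-block (L ∸ α) α w t' r' 0<α lw'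

StartsMarked-block : ∀ β α w r → 0 < β → length w ≡ β + α → StartsMarked (block β α w ++ r)
StartsMarked-block (suc β) α (t ∷ w) r _ _ = refl

unmarkedCounts-< : ∀ L k α → α ∈ unmarkedCounts L k → α < L × (k ≡ 0 ⊎ 0 < α)
unmarkedCounts-< L zero α m = ∈-upTo⁻ m , inj₁ refl
unmarkedCounts-< L (suc k) α m with ∈-map⁻ suc m
... | α' , m' , refl = <∸1⇒suc< L (∈-upTo⁻ m') , inj₂ z<s

enumStartsMarked-sound : ∀ f n → n ≤ f → ∀ x → x ∈ enumStartsMarked f n → Admissible n x × StartsMarked x
enumStartsMarked-sound f zero _ .[] (here refl) = (refl , tt , tt) , tt
enumStartsMarked-sound (suc f) (suc n) (s≤s hn) x m with ∈-concatBelow⁻ (suc n) _ m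
... | k , s≤s k≤n , mk with ∈-extensions⁻ (suc n ∸ k) k (unmarkedCounts (suc n ∸ k) k) (enumStartsMarked f k) mk
...   | α , w , r , mα , mw , mr , refl with enumStartsMarked-sound f k (≤-trans k≤n hn) r mr | unmarkedCounts-< (suc n ∸ k) k α mα
...     | (gr , htr) | (α<L , j) =
  subst (λ z → Admissible z (block (L ∸ α) α w ++ r)) (m∸n+n≡m (≤-trans k≤n (n≤1+n n))) (block-++-admissible L k α w r (<⇒≤ α<L) mw gr (jun j)) ,
  StartsMarked-block (L ∸ α) α w r (m<n⇒0<n∸m α<L) (trans (proj₁ (increasing-sound L k w mw)) (sym (m∸n+n≡m (<⇒≤ α<L))))
  where
  L = suc n ∸ k
  jun : (k ≡ 0 ⊎ 0 < α) → Boundary α r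
  jun (inj₁ refl) = inj₁ (length≡0⇒[] r (proj₁ gr))
  jun (inj₂ h) = inj₂ (h , htr)

enumAdmissible-sound : ∀ n x → x ∈ enumAdmissible n → Admissible n x × ones (marks x) < n
enumAdmissible-sound n x m with ∈-concatBelow⁻ n _ m
... | i , i<n , mk with ∈-extensions⁻ (suc i) (n ∸ suc i) (map suc (upTo (suc i))) (enumStartsMarked n (n ∸ suc i)) mk
...   | α , w , r , mα , mw , mr , refl with ∈-map⁻ suc mα
...     | α' , mα' , refl with enumStartsMarked-sound n (n ∸ suc i) (m∸n≤m n (suc i)) r mr
...       | (gr , htr) = subst (λ z → Admissible z x') nk (block-++-admissible (suc i) k α w r α≤ mw gr (inj₂ (s≤s z≤n , htr))) , ones<
  where
  k = n ∸ suc i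
  x' = block (suc i ∸ suc α') (suc α') w ++ r
  α≤ : suc α' ≤ suc i
  α≤ = ∈-upTo⁻ mα'
  nk : suc i + k ≡ n
  nk = m+[n∸m]≡n i<n
  lw' : length w ≡ (suc i ∸ suc α') + suc α'
  lw' = trans (proj₁ (increasing-sound (suc i) k w mw)) (sym (m∸n+n≡m α≤))
  ones< : ones (marks x') < n
  ones< = begin-strict
    ones (marks x') ≡⟨ cong ones (marks-++ (block (suc i ∸ suc α') (suc α') w) r) ⟩
    ones (marks (block (suc i ∸ suc α') (suc α') w) ++ marks r) ≡⟨ ones-++ (marks (block (suc i ∸ suc α') (suc α') w)) (marks r) ⟩
    ones (marks (block (suc i ∸ suc α') (suc α') w)) + ones (marks r) ≡⟨ cong (_+ ones (marks r)) (ones-block (suc i ∸ suc α') (suc α') w lw') ⟩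
    (i ∸ α') + ones (marks r) ≤⟨ +-monoʳ-≤ (i ∸ α') (≤-trans (ones≤length (marks r)) (≤-reflexive (trans (length-map proj₁ r) (proj₁ gr)))) ⟩
    (i ∸ α') + k <⟨ +-monoˡ-< k (s≤s (m∸n≤m i α')) ⟩
    suc i + k ≡⟨ nk ⟩
    n ∎
    where open ≤-Reasoning

Decomposition : ℕ → Marked → Set
Decomposition n x = Σ ℕ λ β → Σ ℕ λ α → Σ (List ℕ) λ w → Σ Marked λ r →
  x ≡ block β α w ++ r × length w ≡ β + α × 0 < β + α × w ∈ increasing (β + α) (length r) × Admissible (length r) r ×
  Boundary α r × n ≡ (β + α) + length r

decompose : ∀ n x → 0 < n → Admissible n x → Decomposition n x
decompose n x 0<n (len , compatible , code) with firstBlock x (subst (0 <_) (sym len) 0<n) compatible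
... | β , α , w , r , refl , len-w , 0<β+α , increasing-w , boundary =
  β , α , w , r , refl , len-w , 0<β+α , increasing-complete (β + α) (length r) w (len-w , increasing-w , w≤) ,
  (refl , Compatible-suffix (block β α w) r compatible , IsCode-suffix w (entries r) code′) , boundary ,
  trans (sym len) (trans (length-++ (block β α w)) (cong (_+ length r) (length-block β α w len-w)))
  where
  code′ : IsCode (w ++ entries r)
  code′ = subst IsCode (trans (entries-++ (block β α w) r) (cong (_++ entries r) (entries-block β α w len-w))) code
  w≤ : All (_≤ length r) w
  w≤ = All-map (subst (_ ≤_) (length-map proj₂ r)) (IsCode-increasing-bound w (entries r) code′ increasing-w)

¬StartsMarked-unmarkedBlock : ∀ α w r → 0 < α → length w ≡ α → StartsMarked (block 0 α w ++ r) → ⊥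
¬StartsMarked-unmarkedBlock (suc α) (t ∷ w) r _ _ ()

∈-extensions⁺′ : ∀ β α k αs R {w r} → α ∈ αs → w ∈ increasing (β + α) k → r ∈ R →
  block β α w ++ r ∈ extensions (β + α) k αs R
∈-extensions⁺′ β α k αs R {w} {r} α∈ w∈ r∈ =
  subst (λ b → block b α w ++ r ∈ extensions (β + α) k αs R) (m+n∸n≡m β α) (∈-extensions⁺ (β + α) k αs R α∈ w∈ r∈)

∈-unmarkedCounts : ∀ β α {r} → Boundary α r → α ∈ unmarkedCounts (suc β + α) (length r)
∈-unmarkedCounts β α {[]} _ = ∈-upTo⁺ (s≤s (m≤n+m α β))
∈-unmarkedCounts β zero {_ ∷ _} (inj₂ (() , _))
∈-unmarkedCounts β (suc α) {_ ∷ _} (inj₂ _) = ∈-map⁺ suc (∈-upTo⁺ (m≤n+m (suc α) β))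

∈-map-suc-upTo : ∀ {α L} → 0 < α → α ≤ L → α ∈ map suc (upTo L)
∈-map-suc-upTo {suc a} _ α≤L = ∈-map⁺ suc (∈-upTo⁺ α≤L)

enumStartsMarked-complete : ∀ f n → n ≤ f → ∀ x → Admissible n x → StartsMarked x → x ∈ enumStartsMarked f n
enumStartsMarked-complete f zero _ [] _ _ = here refl
enumStartsMarked-complete (suc f) (suc n) (s≤s n≤f) x adm marked with decompose (suc n) x z<s adm
... | zero , α , w , r , refl , len , 0<α , _ , _ , _ , _ = ⊥-elim (¬StartsMarked-unmarkedBlock α w r 0<α len marked)
... | suc β , α , w , r , refl , _ , _ , w∈ , adm-r , bnd , n+1≡ =
  ∈-concatBelow⁺ (suc n) _ k k<n+1 (subst (λ L → x ∈ extensions L k (unmarkedCounts L k) (enumStartsMarked f k)) (sym L≡)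
    (∈-extensions⁺′ (suc β) α k _ _ (∈-unmarkedCounts β α bnd) w∈ r∈))
  where
  k = length r
  L≡ : suc n ∸ k ≡ suc β + α
  L≡ = trans (cong (_∸ k) n+1≡) (m+n∸n≡m (suc β + α) k)
  k<n+1 : k < suc n
  k<n+1 = subst (k <_) (sym n+1≡) (s≤s (m≤n+m k (β + α)))
  r∈ : r ∈ enumStartsMarked f k
  r∈ = enumStartsMarked-complete f k (≤-trans (≤-pred k<n+1) n≤f) r adm-r (Boundary⇒StartsMarked bnd)

Boundary-not-all-marked : ∀ β α w r → length w ≡ β + α → Boundary α r →
  ones (marks (block β α w ++ r)) < (β + α) + length r → 0 < α
Boundary-not-all-marked _ _ _ _ _ (inj₂ (0<α , _)) _ = 0<α
Boundary-not-all-marked _ (suc α) _ _ _ (inj₁ _) _ = z<s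
Boundary-not-all-marked β zero w [] len (inj₁ refl) ones< = ⊥-elim (<-irrefl all-marked ones<)
  where
  all-marked : ones (marks (block β 0 w ++ [])) ≡ (β + 0) + 0
  all-marked = begin
    ones (marks (block β 0 w ++ []))  ≡⟨ cong (λ y → ones (marks y)) (++-identityʳ (block β 0 w)) ⟩
    ones (marks (block β 0 w))        ≡⟨ ones-block β 0 w len ⟩
    β                                 ≡⟨ trans (+-identityʳ (β + 0)) (+-identityʳ β) ⟨
    (β + 0) + 0                       ∎
    where open ≡-Reasoning

enumAdmissible-complete : ∀ n x → Admissible n x → ones (marks x) < n → x ∈ enumAdmissible n
enumAdmissible-complete (suc n) x adm ones<n+1 with decompose (suc n) x z<s adm
... | β , α , w , r , refl , len , 0<β+α , w∈ , adm-r , bnd , n+1≡ = go (β + α) refl 0<β+α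
  where
  k = length r
  0<α : 0 < α
  0<α = Boundary-not-all-marked β α w r len bnd (subst (ones (marks (block β α w ++ r)) <_) n+1≡ ones<n+1)
  go : ∀ L → L ≡ β + α → 0 < L → block β α w ++ r ∈ enumAdmissible (suc n)
  go (suc i) L≡ _ = ∈-concatBelow⁺ (suc n) _ i i<n+1
    (subst (λ k → x′ ∈ extensions (suc i) k (map suc (upTo (suc i))) (enumStartsMarked (suc n) k)) (sym n+1∸[i+1]≡k)
      (subst (λ L → x′ ∈ extensions L k (map suc (upTo L)) (enumStartsMarked (suc n) k)) (sym L≡)
        (∈-extensions⁺′ β α k _ _ (∈-map-suc-upTo 0<α (m≤n+m α β)) w∈ r∈)))
    where
    x′ = block β α w ++ r
    n+1≡i+1+k : suc n ≡ suc i + k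
    n+1≡i+1+k = trans n+1≡ (cong (_+ k) (sym L≡))
    i<n+1 : i < suc n
    i<n+1 = subst (i <_) (sym n+1≡i+1+k) (s≤s (m≤m+n i k))
    n+1∸[i+1]≡k : suc n ∸ suc i ≡ k
    n+1∸[i+1]≡k = trans (cong (_∸ suc i) n+1≡i+1+k) (m+n∸m≡n (suc i) k)
    r∈ : r ∈ enumStartsMarked (suc n) k
    r∈ = enumStartsMarked-complete (suc n) k (subst (k ≤_) (sym n+1≡i+1+k) (m≤n+m k (suc i))) r adm-r (Boundary⇒StartsMarked bnd)

firstBlockLength-extensions : ∀ L k αs R x → x ∈ extensions L k αs R → (∀ α → α ∈ αs → α ≤ L) → 0 < L →
              (∀ r α → r ∈ R → α ∈ αs → Boundary α r) → firstBlockLength x ≡ L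
firstBlockLength-extensions L k αs R x m hα hL hj with ∈-extensions⁻ L k αs R m
... | α , w , r , mα , mw , mr , refl =
  trans (firstBlockLength-block (L ∸ α) α w r lw' (subst (0 <_) (sym (m∸n+n≡m (hα α mα))) hL) (hj r α mr mα)) (m∸n+n≡m (hα α mα))
  where
  lw' : length w ≡ (L ∸ α) + α
  lw' = trans (proj₁ (increasing-sound L k w mw)) (sym (m∸n+n≡m (hα α mα)))

unmarkedCounts-unique : ∀ L k → Unique (unmarkedCounts L k)
unmarkedCounts-unique L zero = upTo⁺ L
unmarkedCounts-unique L (suc k) = Unique-map⁺ suc-injective (upTo⁺ (L ∸ 1))

enumStartsMarked-unique : ∀ f n → n ≤ f → Unique (enumStartsMarked f n)
enumStartsMarked-unique f zero _ = [] ∷ []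
enumStartsMarked-unique (suc f) (suc n) (s≤s n≤f) = concatBelow-unique (suc n) _ (λ x → suc n ∸ firstBlockLength x) piece! index-correct
  where
  piece : ℕ → List Marked
  piece k = extensions (suc n ∸ k) k (unmarkedCounts (suc n ∸ k) k) (enumStartsMarked f k)
  α≤L : ∀ k {α} → α ∈ unmarkedCounts (suc n ∸ k) k → α ≤ suc n ∸ k
  α≤L k α∈ = <⇒≤ (proj₁ (unmarkedCounts-< _ k _ α∈))
  piece! : ∀ k → k < suc n → Unique (piece k)
  piece! k (s≤s k≤n) = extensions-unique (suc n ∸ k) k _ _ (unmarkedCounts-unique _ k) (All-tab (α≤L k)) (enumStartsMarked-unique f k (≤-trans k≤n n≤f))
  index-correct : ∀ k x → k < suc n → x ∈ piece k → suc n ∸ firstBlockLength x ≡ k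
  index-correct k x (s≤s k≤n) x∈ =
    trans (cong (suc n ∸_) (firstBlockLength-extensions (suc n ∸ k) k _ _ x x∈ (λ _ → α≤L k) (m<n⇒0<n∸m (s≤s k≤n)) boundary))
          (m∸[m∸n]≡n (≤-trans k≤n (n≤1+n n)))
    where
    boundary : ∀ r α → r ∈ enumStartsMarked f k → α ∈ unmarkedCounts (suc n ∸ k) k → Boundary α r
    boundary r α r∈ α∈ with enumStartsMarked-sound f k (≤-trans k≤n n≤f) r r∈ | proj₂ (unmarkedCounts-< _ k α α∈)
    ... | (len , _) , _ | inj₁ refl = inj₁ (length≡0⇒[] r len)
    ... | _ , marked | inj₂ 0<α = inj₂ (0<α , marked)

enumAdmissible-unique : ∀ n → Unique (enumAdmissible n)
enumAdmissible-unique n = concatBelow-unique n _ (λ x → firstBlockLength x ∸ 1) piece! index-correct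
  where
  piece : ℕ → List Marked
  piece i = extensions (suc i) (n ∸ suc i) (map suc (upTo (suc i))) (enumStartsMarked n (n ∸ suc i))
  positive : ∀ i {α} → α ∈ map suc (upTo (suc i)) → α ≤ suc i × 0 < α
  positive i α∈ with ∈-map⁻ suc α∈
  ... | _ , a∈ , refl = ∈-upTo⁻ a∈ , z<s
  piece! : ∀ i → i < n → Unique (piece i)
  piece! i _ = extensions-unique (suc i) (n ∸ suc i) _ _ (Unique-map⁺ suc-injective (upTo⁺ (suc i))) (All-tab (proj₁ ∘ positive i))
                                 (enumStartsMarked-unique n (n ∸ suc i) (m∸n≤m n (suc i)))
  index-correct : ∀ i x → i < n → x ∈ piece i → firstBlockLength x ∸ 1 ≡ i
  index-correct i x _ x∈ = cong (_∸ 1) (firstBlockLength-extensions (suc i) (n ∸ suc i) _ _ x x∈ (λ _ → proj₁ ∘ positive i) z<s boundary)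
    where
    boundary : ∀ r α → r ∈ enumStartsMarked n (n ∸ suc i) → α ∈ map suc (upTo (suc i)) → Boundary α r
    boundary r α r∈ α∈ = inj₂ (proj₂ (positive i α∈) , proj₂ (enumStartsMarked-sound n (n ∸ suc i) (m∸n≤m n (suc i)) r r∈))

length-unmarkedCounts : ∀ L k → length (unmarkedCounts L k) ≡ unmarkedChoices L k
length-unmarkedCounts L zero = length-upTo L
length-unmarkedCounts L (suc k) = trans (length-map suc (upTo (L ∸ 1))) (length-upTo (L ∸ 1))

length-enumStartsMarked : ∀ f n → n ≤ f → length (enumStartsMarked f n) ≡ n !
length-enumStartsMarked f zero _ = refl
length-enumStartsMarked (suc f) (suc n) (s≤s n≤f) = begin
  length (enumStartsMarked (suc f) (suc n))                             ≡⟨ length-concatBelow (suc n) _ ⟩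
  sumBelow (suc n) (λ k → length (piece k))                             ≡⟨ sumBelow-cong (suc n) _ _ length-piece ⟩
  sumBelow (suc n) (λ k → unmarkedChoices (suc n ∸ k) k * rising (suc n ∸ k) k) ≡⟨ sumBelow-telescope (suc n) (suc n) z<s ≤-refl ⟩
  rising (suc n ∸ suc n) (suc n)                                        ≡⟨ cong (λ z → rising z (suc n)) (n∸n≡0 n) ⟩
  rising 0 (suc n)                                                      ≡⟨ rising-zero (suc n) ⟩
  (suc n) !                                                             ∎
  where
  open ≡-Reasoning
  piece : ℕ → List Marked
  piece k = extensions (suc n ∸ k) k (unmarkedCounts (suc n ∸ k) k) (enumStartsMarked f k)
  length-piece : ∀ k → k < suc n → length (piece k) ≡ unmarkedChoices (suc n ∸ k) k * rising (suc n ∸ k) k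
  length-piece k (s≤s k≤n) =
    trans (length-extensions (suc n ∸ k) k (unmarkedCounts (suc n ∸ k) k) (enumStartsMarked f k))
          (cong₂ _*_ (length-unmarkedCounts (suc n ∸ k) k) (begin
    length (increasing (suc n ∸ k) k) * length (enumStartsMarked f k)
      ≡⟨ cong (length (increasing (suc n ∸ k) k) *_) (length-enumStartsMarked f k (≤-trans k≤n n≤f)) ⟩
    length (increasing (suc n ∸ k) k) * k !                           ≡⟨ length-increasing*! (suc n ∸ k) k ⟩
    rising (suc n ∸ k) k                                              ∎))

length-enumAdmissible : ∀ n → length (enumAdmissible n) ≡ sumBelow n (factQuot n)
length-enumAdmissible n = trans (length-concatBelow n _) (sumBelow-cong n _ _ length-piece)
  where
  length-piece : ∀ i → i < n → length (extensions (suc i) (n ∸ suc i) (map suc (upTo (suc i))) (enumStartsMarked n (n ∸ suc i))) ≡ factQuot n i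
  length-piece i i<n = begin
    length (extensions (suc i) k αs (enumStartsMarked n k))                 ≡⟨ length-extensions (suc i) k αs (enumStartsMarked n k) ⟩
    length αs * (length (increasing (suc i) k) * length (enumStartsMarked n k))
      ≡⟨ cong₂ (λ a b → a * (length (increasing (suc i) k) * b)) length-αs (length-enumStartsMarked n k (m∸n≤m n (suc i))) ⟩
    suc i * (length (increasing (suc i) k) * k !)                           ≡⟨ cong (suc i *_) (length-increasing*! (suc i) k) ⟩
    suc i * rising (suc i) k                                                ≡⟨ rising-suc i k ⟨
    rising i (suc k)                                                        ≡⟨ cong (rising i) (∸≡suc∸suc n i i<n) ⟨
    rising i (n ∸ i)                                                        ≡⟨ factQuot≡rising n i (<⇒≤ i<n) ⟨
    factQuot n i                                                            ∎
    where
    open ≡-Reasoning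
    k = n ∸ suc i
    αs = map suc (upTo (suc i))
    length-αs : length αs ≡ suc i
    length-αs = trans (length-map suc (upTo (suc i))) (length-upTo (suc i))

-- Normal sequences ending in Δ_{n-1}

LeftDiv-resp-≈ : ∀ {n x y y'} → y ≈ y' → LeftDiv n x y → LeftDiv n x y'
LeftDiv-resp-≈ e (z , vz , p) = z , vz , ≈-trans p e

RightDiv-resp-≈ : ∀ {n x y y'} → y ≈ y' → RightDiv n x y → RightDiv n x y'
RightDiv-resp-≈ e (z , vz , p) = z , vz , ≈-trans p e

DRsupDL-resp-≈ : ∀ {n x x' y y'} → x ≈ x' → y ≈ y' → DRsupDL n x y → DRsupDL n x' y'
DRsupDL-resp-≈ x≈ y≈ ⊇ a 0<a a<n ld = RightDiv-resp-≈ x≈ (⊇ a 0<a a<n (LeftDiv-resp-≈ (≈-sym y≈) ld))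

Δ≈codeWord-code₃ : ∀ m → Δ m ≈ codeWord (code₃ 0 m)
Δ≈codeWord-code₃ m = ≈-trans (Δ≈codeWord-topCode m) (≈-reflexive (sym (begin
  codeWord (topCode m) ++ run m (length (topCode m) ∸ m)  ≡⟨ cong (λ k → codeWord (topCode m) ++ run m (k ∸ m)) (length-topCode m) ⟩
  codeWord (topCode m) ++ run m (m ∸ m)                   ≡⟨ cong (λ k → codeWord (topCode m) ++ run m k) (n∸n≡0 m) ⟩
  codeWord (topCode m) ++ []                              ≡⟨ ++-identityʳ (codeWord (topCode m)) ⟩
  codeWord (topCode m)                                    ∎)))
  where open ≡-Reasoning

Δ-simple : ∀ m → Simple (suc m) (Δ m)
Δ-simple m with codeWord-simple (suc m) (code₃ 0 m) (code₃-isCode 0 m) (length-code₃ 0 m)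
... | _ , z , vz , e = Valid-mono (Δ m) (n≤1+n m) (Δ-valid m) , z , vz , ≈-trans (≈-++ʳ z (Δ≈codeWord-code₃ m)) e

LeftDiv-Δ : ∀ m a → 0 < a → a < m → LeftDiv (suc m) [ a ] (Δ m)
LeftDiv-Δ m a 0<a a<m = LeftDiv-resp-≈ (≈-sym (Δ≈codeWord-code₃ m))
  (leftDescent⇒LeftDiv (suc m) (code₃ 0 m) a (code₃-isCode 0 m) (length-code₃ 0 m) 0<a a<m+1
    (leftDescent-code₃ 0 m a 0<a a<m+1 (λ a≡m → <-irrefl a≡m a<m)))
  where
  a<m+1 = ≤-trans a<m (n≤1+n m)

LeftDiv-Δ⇒< : ∀ m a → 0 < a → a < suc m → LeftDiv (suc m) [ a ] (Δ m) → a < m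
LeftDiv-Δ⇒< m a 0<a (s≤s a≤m) ld with m≤n⇒m<n∨m≡n a≤m
... | inj₁ a<m = a<m
... | inj₂ refl = ⊥-elim (false≢true (trans (sym (leftDescent-code₃-gap 0 a 0<a))
  (LeftDiv⇒leftDescent (suc a) (code₃ 0 a) a (code₃-isCode 0 a) (length-code₃ 0 a) 0<a (s≤s a≤m) (LeftDiv-resp-≈ (Δ≈codeWord-code₃ a) ld))))

code₃-Δ-normal : ∀ m r j → r + j ≡ m → DRsupDL (suc m) (codeWord (code₃ r j)) (Δ m)
code₃-Δ-normal m r j r+j≡m a 0<a a<m+1 ld =
  rightDescent⇒RightDiv (suc m) (code₃ r j) a (code₃-isCode r j) len 0<a a<m+1
    (rightDescent-code₃ r j a 0<a (subst (a <_) (sym r+j≡m) (LeftDiv-Δ⇒< m a 0<a a<m+1 ld)))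
  where
  len : length (code₃ r j) ≡ suc m
  len = trans (length-code₃ r j) (trans (+-suc r j) (cong suc r+j≡m))

code₂-code₃-normal : ∀ n s r → length s ≡ n → r + suc (ones s) ≡ n →
  DRsupDL n (codeWord (code₂ s)) (codeWord (code₃ r (ones s)))
code₂-code₃-normal n s r len len₃ a 0<a a<n ld =
  rightDescent⇒RightDiv n (code₂ s) a (code₂-isCode s) (trans (length-code₂ s) len) 0<a a<n
    (rightDescent-code₂ s a 0<a (subst (a <_) (sym len) a<n) a≢ones)
  where
  a≢ones : a ≢ ones s
  a≢ones refl = false≢true (trans (sym (leftDescent-code₃-gap r a 0<a))
    (LeftDiv⇒leftDescent n (code₃ r a) a (code₃-isCode r a) (trans (length-code₃ r a) len₃) 0<a a<n ld))

entries-code₂-normal : ∀ n x → length x ≡ n → Compatible x → IsCode (entries x) →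
  DRsupDL n (reverse (codeWord (entries x))) (codeWord (code₂ (marks x)))
entries-code₂-normal n x len compatible hd a 0<a a<n ld =
  leftDescent⇒RightDiv-reverse n (entries x) a hd (trans (length-entries x) len) 0<a a<n
    (Compatible⇒LeftDescentsIncluded x compatible a 0<a (subst (a <_) (sym len) a<n)
      (LeftDiv⇒leftDescent n (code₂ (marks x)) a (code₂-isCode (marks x)) (trans (length-code₂ (marks x)) (trans (length-marks x) len)) 0<a a<n ld))

triple : ℕ → Marked → Vec Word 3
triple n x = reverse (codeWord (entries x)) v∷ codeWord (code₂ (marks x)) v∷ codeWord (code₃ (n ∸ suc j) j) v∷ v[]
  where j = ones (marks x)

triple-normal : ∀ m x → Admissible (suc m) x → ones (marks x) < suc m → Normal (suc m) (toList (triple (suc m) x) ++ [ Δ m ])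
triple-normal m x (len , compatible , hd) j<n =
  (reverse-codeWord-simple n d hd (trans (length-entries x) len) ∷
   codeWord-simple n (code₂ s) (code₂-isCode s) (trans (length-code₂ s) len-s) ∷
   codeWord-simple n (code₃ r j) (code₃-isCode r j) (trans (length-code₃ r j) r+j+1≡n) ∷
   Δ-simple m ∷ []) ,
  entries-code₂-normal n x len compatible hd ,
  code₂-code₃-normal n s r len-s r+j+1≡n ,
  code₃-Δ-normal m r j (suc-injective (trans (sym (+-suc r j)) r+j+1≡n)) ,
  tt
  where
  n = suc m
  s = marks x
  d = entries x
  j = ones s
  r = n ∸ suc j
  len-s : length s ≡ n
  len-s = trans (length-marks x) len
  r+j+1≡n : r + suc j ≡ n
  r+j+1≡n = m∸n+n≡m j<n

third-factor : ∀ m y → Simple (suc m) y → DRsupDL (suc m) y (Δ m) →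
  Σ ℕ λ r → Σ ℕ λ j → r + suc j ≡ suc m × y ≈ codeWord (code₃ r j)
third-factor m y simple ⊇Δ with simple⇒hasCode (suc m) y simple
... | e , he , len , y≈ , _ with code₃-complete e he (subst (0 <_) (sym len) z<s) descents
  where
  descents : ∀ a → 0 < a → a < length e ∸ 1 → rightDescent e a ≡ true
  descents a 0<a a<m = RightDiv⇒rightDescent (suc m) e a he len 0<a a<m+1 (RightDiv-resp-≈ y≈ (⊇Δ a 0<a a<m+1 (LeftDiv-Δ m a 0<a a<m′)))
    where
    a<m′ = subst (λ k → a < k ∸ 1) len a<m
    a<m+1 = ≤-trans a<m′ (n≤1+n m)
... | r , j , refl = r , j , trans (sym (length-code₃ r j)) len , y≈

second-factor : ∀ n r j y → r + suc j ≡ n → Simple n y → DRsupDL n y (codeWord (code₃ r j)) →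
  Σ (List Bool) λ s → length s ≡ n × ones s ≡ j × y ≈ codeWord (code₂ s)
second-factor n r j y r+j+1≡n simple ⊇₃ with simple⇒hasCode n y simple
... | e , he , len , y≈ , _ with code₂-complete e j he j≤ descents
  where
  j≤ : j ≤ length e
  j≤ = subst (j ≤_) (trans r+j+1≡n (sym len)) (≤-trans (n≤1+n j) (m≤n+m (suc j) r))
  descents : ∀ a → 0 < a → a < length e → a ≢ j → rightDescent e a ≡ true
  descents a 0<a a<e a≢j = RightDiv⇒rightDescent n e a he len 0<a a<n (RightDiv-resp-≈ y≈ (⊇₃ a 0<a a<n ld₃))
    where
    a<n = subst (a <_) len a<e
    ld₃ : LeftDiv n [ a ] (codeWord (code₃ r j))
    ld₃ = leftDescent⇒LeftDiv n (code₃ r j) a (code₃-isCode r j) (trans (length-code₃ r j) r+j+1≡n) 0<a a<n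
            (leftDescent-code₃ r j a 0<a (subst (a <_) (sym r+j+1≡n) a<n) a≢j)
... | s , len-s , ones≡ , refl = s , trans len-s len , ones≡ , y≈

first-factor : ∀ n y → Simple n y → Σ (List ℕ) λ d → IsCode d × length d ≡ n × y ≈ reverse (codeWord d)
first-factor n y simple@(valid , _)
  with reduced⇒hasCode n (reverse y) (Reduced-reverse n y (simple⇒reduced n y simple) valid) (All-reverse y valid)
... | d , hd , len , ry≈ , _ = d , hd , len , ≈-subst (reverse-involutive y) refl (≈-reverse ry≈)

zipMarked : List Bool → List ℕ → Marked
zipMarked (b ∷ s) (t ∷ d) = (b , t) ∷ zipMarked s d
zipMarked _ _ = []

marks-zipMarked : ∀ s d → length s ≡ length d → marks (zipMarked s d) ≡ s
marks-zipMarked [] [] _ = refl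
marks-zipMarked (b ∷ s) (t ∷ d) l = cong (b ∷_) (marks-zipMarked s d (suc-injective l))

entries-zipMarked : ∀ s d → length s ≡ length d → entries (zipMarked s d) ≡ d
entries-zipMarked [] [] _ = refl
entries-zipMarked (b ∷ s) (t ∷ d) l = cong (t ∷_) (entries-zipMarked s d (suc-injective l))

length-zipMarked : ∀ s d → length s ≡ length d → length (zipMarked s d) ≡ length s
length-zipMarked [] [] _ = refl
length-zipMarked (b ∷ s) (t ∷ d) l = cong suc (length-zipMarked s d (suc-injective l))

zipMarked-leftDescentsIncluded : ∀ n s d → length s ≡ n → length d ≡ n → IsCode d →
  DRsupDL n (reverse (codeWord d)) (codeWord (code₂ s)) → LeftDescentsIncluded (zipMarked s d)
zipMarked-leftDescentsIncluded n s d len-s len-d hd ⊇ a 0<a a<x d₂ =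
  subst (λ e → leftDescent e a ≡ true) (sym (entries-zipMarked s d s≡d))
    (RightDiv-reverse⇒leftDescent n d a hd len-d 0<a a<n
      (⊇ a 0<a a<n (leftDescent⇒LeftDiv n (code₂ s) a (code₂-isCode s) (trans (length-code₂ s) len-s) 0<a a<n
        (subst (λ s′ → leftDescent (code₂ s′) a ≡ true) (marks-zipMarked s d s≡d) d₂))))
  where
  s≡d = trans len-s (sym len-d)
  a<n = subst (a <_) (trans (length-zipMarked s d s≡d) len-s) a<x

triple-complete : ∀ m v → NormalPrefix (suc m) 4 (Δ m) v → Any (Pointwise _≈_ v) (map (triple (suc m)) (enumAdmissible (suc m)))
triple-complete m (y₁ v∷ y₂ v∷ y₃ v∷ v[]) ((s₁ ∷ s₂ ∷ s₃ ∷ _ ∷ []) , ⊇₁₂ , ⊇₂₃ , ⊇₃Δ , _)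
  with third-factor m y₃ s₃ ⊇₃Δ
... | r , j , r+j+1≡n , y₃≈ with second-factor (suc m) r j y₂ r+j+1≡n s₂ (DRsupDL-resp-≈ ≈-refl y₃≈ ⊇₂₃)
... | s , len-s , ones≡j , y₂≈ with first-factor (suc m) y₁ s₁
... | d , hd , len-d , y₁≈ = Any-map (λ { refl → y≈triple }) (∈-map⁺ (triple n) x∈)
  where
  n = suc m
  s≡d = trans len-s (sym len-d)
  x = zipMarked s d
  marks≡ : marks x ≡ s
  marks≡ = marks-zipMarked s d s≡d
  entries≡ : entries x ≡ d
  entries≡ = entries-zipMarked s d s≡d
  ones≡ : ones (marks x) ≡ j
  ones≡ = trans (cong ones marks≡) ones≡j
  x∈ : x ∈ enumAdmissible n
  x∈ = enumAdmissible-complete n x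
    (trans (length-zipMarked s d s≡d) len-s ,
     LeftDescentsIncluded⇒Compatible x (zipMarked-leftDescentsIncluded n s d len-s len-d hd (DRsupDL-resp-≈ y₁≈ y₂≈ ⊇₁₂)) ,
     subst IsCode (sym entries≡) hd)
    (subst (_< n) (sym ones≡) (subst (j <_) r+j+1≡n (m≤n+m (suc j) r)))
  n∸[j+1]≡r : n ∸ suc (ones (marks x)) ≡ r
  n∸[j+1]≡r = trans (cong (λ k → n ∸ suc k) ones≡) (trans (cong (_∸ suc j) (sym r+j+1≡n)) (m+n∸n≡m r (suc j)))
  y≈triple : Pointwise _≈_ (y₁ v∷ y₂ v∷ y₃ v∷ v[]) (triple n x)
  y≈triple = subst (λ e → y₁ ≈ reverse (codeWord e)) (sym entries≡) y₁≈ p∷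
             subst (λ s′ → y₂ ≈ codeWord (code₂ s′)) (sym marks≡) y₂≈ p∷
             subst₂ (λ r′ j′ → y₃ ≈ codeWord (code₃ r′ j′)) (sym n∸[j+1]≡r) (sym ones≡) y₃≈ p∷ p[]

marks-entries-injective : ∀ x y → marks x ≡ marks y → entries x ≡ entries y → x ≡ y
marks-entries-injective [] [] _ _ = refl
marks-entries-injective [] (_ ∷ _) () _
marks-entries-injective (_ ∷ _) [] () _
marks-entries-injective ((b , t) ∷ x) ((b' , t') ∷ y) e₁ e₂ =
  cong₂ _∷_ (cong₂ _,_ (∷-injectiveˡ e₁) (∷-injectiveˡ e₂)) (marks-entries-injective x y (∷-injectiveʳ e₁) (∷-injectiveʳ e₂))

code₂-injective : ∀ s s' → ones s ≡ ones s' → code₂ s ≡ code₂ s' → s ≡ s'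
code₂-injective [] [] _ _ = refl
code₂-injective [] (true ∷ _) _ ()
code₂-injective [] (false ∷ _) _ ()
code₂-injective (true ∷ _) [] _ ()
code₂-injective (false ∷ _) [] _ ()
code₂-injective (true ∷ s) (true ∷ s') o e = cong (true ∷_) (code₂-injective s s' (suc-injective o) (∷-injectiveʳ e))
code₂-injective (false ∷ s) (false ∷ s') o e = cong (false ∷_) (code₂-injective s s' o (∷-injectiveʳ e))
code₂-injective (true ∷ s) (false ∷ s') o e with trans o (sym (∷-injectiveˡ e))
... | ()
code₂-injective (false ∷ s) (true ∷ s') o e with trans (sym o) (∷-injectiveˡ e)
... | ()

AdmissibleBelow : ℕ → Marked → Set
AdmissibleBelow n x = Admissible n x × ones (marks x) < n

triple-injective : ∀ m x y → AdmissibleBelow (suc m) x → AdmissibleBelow (suc m) y →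
  Pointwise _≈_ (triple (suc m) x) (triple (suc m) y) → x ≡ y
triple-injective m x y ((len-x , _ , hx) , jx<n) ((len-y , _ , hy) , jy<n) (x₁≈ p∷ x₂≈ p∷ x₃≈ p∷ p[]) =
  marks-entries-injective x y marks≡ entries≡
  where
  n = suc m
  entries≡ : entries x ≡ entries y
  entries≡ = codeWord-injective n (entries x) (entries y) hx hy (trans (length-entries x) len-x) (trans (length-entries y) len-y)
               (≈-subst (reverse-involutive _) (reverse-involutive _) (≈-reverse x₁≈))
  length-code₃′ : ∀ j → j < n → length (code₃ (n ∸ suc j) j) ≡ n
  length-code₃′ j j<n = trans (length-code₃ _ j) (m∸n+n≡m j<n)
  r+j≡m : ∀ j → j < n → (n ∸ suc j) + j ≡ m
  r+j≡m j j<n = suc-injective (trans (sym (+-suc (n ∸ suc j) j)) (m∸n+n≡m j<n))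
  ones≡ : ones (marks x) ≡ ones (marks y)
  ones≡ = code₃-injective _ _ _ _
    (codeWord-injective n _ _ (code₃-isCode _ _) (code₃-isCode _ _) (length-code₃′ _ jx<n) (length-code₃′ _ jy<n) x₃≈)
    (trans (r+j≡m _ jx<n) (sym (r+j≡m _ jy<n)))
  marks≡ : marks x ≡ marks y
  marks≡ = code₂-injective (marks x) (marks y) ones≡
    (codeWord-injective n _ _ (code₂-isCode (marks x)) (code₂-isCode (marks y))
      (trans (length-code₂ (marks x)) (trans (length-marks x) len-x)) (trans (length-code₂ (marks y)) (trans (length-marks y) len-y)) x₂≈)

AllPairs-map-All : ∀ {A B : Set} {R : A → A → Set} {S : B → B → Set} {Q : A → Set} (f : A → B) xs →
  (∀ {x y} → Q x → Q y → R x y → S (f x) (f y)) → All Q xs → AllPairs R xs → AllPairs S (map f xs)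
AllPairs-map-All f [] _ [] [] = []
AllPairs-map-All {R = R} {S} {Q} f (x ∷ xs) g (qx ∷ qs) (rx ∷ rs) = map-related xs qs rx ∷ AllPairs-map-All f xs g qs rs
  where
  map-related : ∀ ys → All Q ys → All (R x) ys → All (S (f x)) (map f ys)
  map-related [] [] [] = []
  map-related (y ∷ ys) (qy ∷ qys) (r ∷ rs′) = g qx qy r ∷ map-related ys qys rs′

triples-normal : ∀ m → All (NormalPrefix (suc m) 4 (Δ m)) (map (triple (suc m)) (enumAdmissible (suc m)))
triples-normal m = All-map⁺ (All-tab (λ {x} x∈ → uncurry (triple-normal m x) (enumAdmissible-sound (suc m) x x∈)))

triples-distinct : ∀ m → AllPairs (λ u v → ¬ Pointwise _≈_ u v) (map (triple (suc m)) (enumAdmissible (suc m)))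
triples-distinct m = AllPairs-map-All (triple (suc m)) (enumAdmissible (suc m))
  (λ {x} {y} adm-x adm-y x≢y pw → x≢y (triple-injective m x y adm-x adm-y pw))
  (All-tab (λ {x} x∈ → enumAdmissible-sound (suc m) x x∈)) (enumAdmissible-unique (suc m))

proposition4p6 : ∀ (n : ℕ) → 1 ≤ n → BCount n 4 (Δ (n ∸ 1)) (sumBelow n (λ i → factQuot n i))
proposition4p6 (suc m) _ =
  map (triple (suc m)) (enumAdmissible (suc m)) ,
  triples-normal m ,
  triples-distinct m ,
  triple-complete m ,
  trans (length-map (triple (suc m)) (enumAdmissible (suc m))) (length-enumAdmissible (suc m))
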